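{- Let $G$ be a connected graph with $n$ vertices and $m$ edges. Let $i,j\in V(G)$ be vertices that are not adjacent in $G$, and let $G+ij$ be the graph obtained from $G$ by adding the edge $ij$. Then $$\frac{1}{\Omega_G(i,j)}<C(G+ij)-C(G)\le \frac{m+1}{\Omega_G(i,j)}.$$ The upper bound is attained if and only if $G$ is the path $P_n$ and $i,j$ are its two end vertices.
   Context: All graphs are finite and simple. For a connected graph $G$, regard each edge as a unit resistor. $\Omega_G(i,j)$ is the effective resistance (resistance distance) between $i$ and $j$. The global cyclicity index is $$C(G)=\sum_{ij\in E(G)}\Big[\frac{1}{\Omega_G(i,j)}-1\Big].$$ -}

module Defs where

open import Data.Bool using (Bool; true; false; _∧_; _∨_; if_then_else_)
open import Data.Nat as ℕ using (ℕ; zero; suc; _∸_)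
open import Data.Fin as Fin using (Fin; toℕ)
open import Data.Fin.Permutation using (Permutation′; _⟨$⟩ʳ_)
open import Data.Integer using (+_)
open import Data.Rational using (ℚ; 0ℚ; 1ℚ; _+_; _-_; _*_; _/_; 1/_; ≢-nonZero)
open import Data.Rational.Properties using (_≟_)
open import Data.Product using (Σ; ∃; _×_; _,_)
open import Data.Sum using (_⊎_)
open import Relation.Nullary using (yes; no; ¬_)
open import Relation.Nullary.Decidable using (⌊_⌋)
open import Relation.Binary.PropositionalEquality using (_≡_; _≢_)
open import Function.Bundles using (_⇔_)

Adj : ℕ → Set
Adj n = Fin n → Fin n → Bool

IsSimple : ∀ {n} → Adj n → Set
IsSimple {n} A = (∀ a b → A a b ≡ A b a) × (∀ a → A a a ≡ false)

data Reach {n} (A : Adj n) : Fin n → Fin n → Set where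
  here : ∀ {a} → Reach A a a
  step : ∀ {a b c} → A a b ≡ true → Reach A b c → Reach A a c

Connected : ∀ {n} → Adj n → Set
Connected {n} A = ∀ (a b : Fin n) → Reach A a b

addEdge : ∀ {n} → Adj n → Fin n → Fin n → Adj n
addEdge A i j a b =
  A a b ∨ ((⌊ a Fin.≟ i ⌋ ∧ ⌊ b Fin.≟ j ⌋) ∨ (⌊ a Fin.≟ j ⌋ ∧ ⌊ b Fin.≟ i ⌋))

sumℚ : ∀ n → (Fin n → ℚ) → ℚ
sumℚ zero    f = 0ℚ
sumℚ (suc n) f = f Fin.zero + sumℚ n (λ k → f (Fin.suc k))

sumℕ : ∀ n → (Fin n → ℕ) → ℕ
sumℕ zero    f = 0
sumℕ (suc n) f = f Fin.zero ℕ.+ sumℕ n (λ k → f (Fin.suc k))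

bℚ : Bool → ℚ
bℚ b = if b then 1ℚ else 0ℚ

ℕtoℚ : ℕ → ℚ
ℕtoℚ k = (+ k) / 1

-- Total inverse: 1/p for p ≠ 0 (and 0 for p = 0; never used at 0 here).
inv : ℚ → ℚ
inv p with p ≟ 0ℚ
... | yes _ = 0ℚ
... | no p≢0 = 1/_ p {{≢-nonZero p≢0}}

lap : ∀ {n} → Adj n → (Fin n → ℚ) → Fin n → ℚ
lap {n} A v c = sumℚ n (λ x → bℚ (A c x) * (v c - v x))

δ : ∀ {n} → Fin n → Fin n → ℚ
δ a c = bℚ ⌊ a Fin.≟ c ⌋

-- r is the effective resistance between a and b (unit resistors on edges):
-- injecting a unit current at a and extracting it at b produces a potential
-- v (Kirchhoff: L v = e_a - e_b), and r is the potential difference v a - v b.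
IsEffRes : ∀ {n} → Adj n → Fin n → Fin n → ℚ → Set
IsEffRes {n} A a b r =
  Σ (Fin n → ℚ) λ v → (∀ c → lap A v c ≡ δ a c - δ b c) × (r ≡ v a - v b)

IsResistance : ∀ {n} → Adj n → (Fin n → Fin n → ℚ) → Set
IsResistance A Ω = ∀ a b → IsEffRes A a b (Ω a b)

edgeSumℚ : ∀ {n} → Adj n → (Fin n → Fin n → ℚ) → ℚ
edgeSumℚ {n} A f =
  sumℚ n (λ a → sumℚ n (λ b → if (toℕ a ℕ.<ᵇ toℕ b) ∧ A a b then f a b else 0ℚ))

numEdges : ∀ {n} → Adj n → ℕ
numEdges {n} A =
  sumℕ n (λ a → sumℕ n (λ b → if (toℕ a ℕ.<ᵇ toℕ b) ∧ A a b then 1 else 0))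

cyc : ∀ {n} → Adj n → (Fin n → Fin n → ℚ) → ℚ
cyc A Ω = edgeSumℚ A (λ a b → inv (Ω a b) - 1ℚ)

-- G is (isomorphic to) the path P_n, with i and j mapped to its end vertices 0 and n-1.
IsPathWithEnds : ∀ {n} → Adj n → Fin n → Fin n → Set
IsPathWithEnds {n} A i j =
  Σ (Permutation′ n) λ σ →
    (∀ a b → (A a b ≡ true) ⇔
      ((toℕ (σ ⟨$⟩ʳ a) ≡ suc (toℕ (σ ⟨$⟩ʳ b))) ⊎ (toℕ (σ ⟨$⟩ʳ b) ≡ suc (toℕ (σ ⟨$⟩ʳ a)))))
    × (((toℕ (σ ⟨$⟩ʳ i) ≡ 0) × (toℕ (σ ⟨$⟩ʳ j) ≡ n ∸ 1))
       ⊎ ((toℕ (σ ⟨$⟩ʳ j) ≡ 0) × (toℕ (σ ⟨$⟩ʳ i) ≡ n ∸ 1)))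

-- Write Ω(a,b) = v(a) - v(b) for the potential v of the unit a→b flow (Kirchhoff: L v = e_a - e_b), let u be
-- the unit i→j potential, R = Ω(i,j), and s(a,b) = u(a) - u(b) the i→j flow through ab.  Adding ij is a rank-one
-- change of the Laplacian, and v - t u with t = s(a,b)/(1 + R) is the a→b potential of G + ij, so
-- (1 + R) Ω⁺(a,b) = (1 + R) Ω(a,b) - s(a,b)².  By reciprocity and the maximum principle s² ≤ Ω², and Ω ≤ 1 on
-- edges; hence on every old edge 0 ≤ 1/Ω⁺ - 1/Ω ≤ 1/R, with equality on the right iff s² = 1, while the new
-- edge contributes exactly 1/Ω⁺(i,j) - 1 = 1/R.  Summing over the m edges gives both bounds, the lower one
-- strict because some edge of an i–j walk carries a nonzero flow.  In the equality case the whole unit current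
-- crosses every edge: following edges downhill from i gives a walk to j on which u drops by 1 per step, and an
-- edge leaving it would have unit resistance, hence carry none of the i→j flow; so G is the path from i to j.
-- Conversely, on that path the height function is the i→j potential.

module Submission where

open import Defs

module EffectiveResistance where

  open import Data.Bool using (Bool; true; false; _∧_; _∨_; if_then_else_)
  import Data.Bool.Properties as Bool
  open import Data.Nat as ℕ using (ℕ; zero; suc; _∸_)
  import Data.Nat.Properties as ℕ
  import Data.Nat.Coprimality as Coprime
  open import Data.Fin as Fin using (Fin; toℕ)
  import Data.Fin.Properties as Fin
  open import Data.Fin.Permutation using (Permutation′; _⟨$⟩ʳ_; _⟨$⟩ˡ_; inverseˡ; inverseʳ; permutation)
  import Data.Integer as ℤ
  import Data.Integer.Properties as ℤ
  open import Data.Rational as ℚ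
    using (ℚ; 0ℚ; 1ℚ; ½; _+_; _-_; _*_; -_; _≤_; _<_; mkℚ; positive; nonNegative; ≢-nonZero; *<*; *≤*)
  open import Data.Rational.Properties
  import Data.Rational.Unnormalised as ℚᵘ
  import Data.Rational.Unnormalised.Properties as ℚᵘ
  open import Data.Rational.Solver using (module +-*-Solver)
  open import Algebra.Properties.Group +-0-group using ()
    renaming (⁻¹-involutive to neg-involutive; ∙-cancelˡ to +-cancelˡ-≡)
  open import Data.Product using (Σ; _×_; _,_; proj₁; proj₂)
  open import Data.Sum using (_⊎_; inj₁; inj₂; [_,_]′)
  open import Data.Empty using (⊥; ⊥-elim)
  open import Function using (case_of_)
  open import Function.Bundles using (_⇔_; mk⇔; Equivalence)
  open import Relation.Nullary using (yes; no; ¬_; Dec; ofʸ; ofⁿ)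
  open import Relation.Nullary.Decidable using (⌊_⌋; _×-dec_)
  open import Relation.Binary.PropositionalEquality
  open import Relation.Binary.Definitions using (tri<; tri≈; tri>)

  open +-*-Solver

  0<1 : 0ℚ < 1ℚ
  0<1 = *<* (ℤ.+<+ (ℕ.s≤s ℕ.z≤n))

  p≤q⇒0≤q-p : ∀ {p q} → p ≤ q → 0ℚ ≤ q - p
  p≤q⇒0≤q-p {p} {q} p≤q = subst (_≤ q - p) (+-inverseʳ p) (+-monoˡ-≤ (- p) p≤q)

  p<q⇒0<q-p : ∀ {p q} → p < q → 0ℚ < q - p
  p<q⇒0<q-p {p} {q} p<q = subst (_< q - p) (+-inverseʳ p) (+-monoˡ-< (- p) p<q)

  q-p+p≡q : ∀ p q → (q - p) + p ≡ q
  q-p+p≡q = solve 2 (λ p q → (q :- p) :+ p := q) refl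

  0≤q-p⇒p≤q : ∀ {p q} → 0ℚ ≤ q - p → p ≤ q
  0≤q-p⇒p≤q {p} {q} h = subst₂ _≤_ (+-identityˡ p) (q-p+p≡q p q) (+-monoˡ-≤ p h)

  p-q≡0⇒p≡q : ∀ {p q} → p - q ≡ 0ℚ → p ≡ q
  p-q≡0⇒p≡q {p} {q} h = trans (sym (q-p+p≡q q p)) (trans (cong (_+ q) h) (+-identityˡ q))

  +-nonNeg : ∀ {p q} → 0ℚ ≤ p → 0ℚ ≤ q → 0ℚ ≤ p + q
  +-nonNeg {p} {q} 0≤p 0≤q = ≤-trans 0≤p (subst (_≤ p + q) (+-identityʳ p) (+-monoʳ-≤ p 0≤q))

  *-nonNeg : ∀ {p q} → 0ℚ ≤ p → 0ℚ ≤ q → 0ℚ ≤ p * q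
  *-nonNeg {p} {q} 0≤p 0≤q = subst (_≤ p * q) (*-zeroˡ q) (*-monoʳ-≤-nonNeg q {{nonNegative 0≤q}} 0≤p)

  *-pos : ∀ {p q} → 0ℚ < p → 0ℚ < q → 0ℚ < p * q
  *-pos {p} {q} 0<p 0<q = subst (_< p * q) (*-zeroˡ q) (*-monoˡ-<-pos q {{positive 0<q}} 0<p)

  neg-square : ∀ p → (- p) * (- p) ≡ p * p
  neg-square = solve 1 (λ p → (:- p) :* (:- p) := p :* p) refl

  square-nonNeg : ∀ p → 0ℚ ≤ p * p
  square-nonNeg p with ≤-total 0ℚ p
  ... | inj₁ 0≤p = *-nonNeg 0≤p 0≤p
  ... | inj₂ p≤0 = subst (0ℚ ≤_) (neg-square p) (*-nonNeg (neg-antimono-≤ p≤0) (neg-antimono-≤ p≤0))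

  *-cancelʳ-nonNeg : ∀ {p q} → 0ℚ < q → 0ℚ ≤ p * q → 0ℚ ≤ p
  *-cancelʳ-nonNeg {p} {q} 0<q h = *-cancelʳ-≤-pos q {{positive 0<q}} (subst (_≤ p * q) (sym (*-zeroˡ q)) h)

  *-cancelʳ-pos : ∀ {p q} → 0ℚ < q → 0ℚ < p * q → 0ℚ < p
  *-cancelʳ-pos {p} {q} 0<q h = *-cancelʳ-<-nonNeg q {{nonNegative (<⇒≤ 0<q)}} (subst (_< p * q) (sym (*-zeroˡ q)) h)

  *≡0⇒≡0 : ∀ {p q} → 0ℚ < q → p * q ≡ 0ℚ → p ≡ 0ℚ
  *≡0⇒≡0 {p} {q} 0<q h with <-cmp p 0ℚ
  ... | tri≈ _ p≡0 _ = p≡0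
  ... | tri> _ _ p>0 = ⊥-elim (<-irrefl (sym h) (*-pos p>0 0<q))
  ... | tri< p<0 _ _ = ⊥-elim (<-irrefl (sym -pq≡0) (*-pos (neg-antimono-< p<0) 0<q))
    where -pq≡0 : (- p) * q ≡ 0ℚ
          -pq≡0 = trans (solve 2 (λ p q → (:- p) :* q := :- (p :* q)) refl p q) (cong -_ h)

  square≡0⇒≡0 : ∀ p → p * p ≡ 0ℚ → p ≡ 0ℚ
  square≡0⇒≡0 p h with <-cmp p 0ℚ
  ... | tri≈ _ p≡0 _ = p≡0
  ... | tri> _ _ p>0 = *≡0⇒≡0 p>0 h
  ... | tri< p<0 _ _ = ⊥-elim (<-irrefl (sym (trans (neg-square p) h)) (*-pos (neg-antimono-< p<0) (neg-antimono-< p<0)))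

  square-pos : ∀ {p} → p ≢ 0ℚ → 0ℚ < p * p
  square-pos {p} p≢0 with <-cmp p 0ℚ
  ... | tri≈ _ p≡0 _ = ⊥-elim (p≢0 p≡0)
  ... | tri> _ _ p>0 = *-pos p>0 p>0
  ... | tri< p<0 _ _ = subst (0ℚ <_) (neg-square p) (*-pos (neg-antimono-< p<0) (neg-antimono-< p<0))

  nonNeg+nonNeg≡0⇒≡0 : ∀ {p q} → 0ℚ ≤ p → 0ℚ ≤ q → p + q ≡ 0ℚ → p ≡ 0ℚ
  nonNeg+nonNeg≡0⇒≡0 {p} {q} 0≤p 0≤q p+q≡0 =
    ≤-antisym (subst (p ≤_) p+q≡0 (subst (_≤ p + q) (+-identityʳ p) (+-monoʳ-≤ p 0≤q))) 0≤p

  square≡1⇒±1 : ∀ p → p * p ≡ 1ℚ → p ≡ 1ℚ ⊎ p ≡ - 1ℚ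
  square≡1⇒±1 p h with 0ℚ ≤? p
  ... | yes 0≤p = inj₁ (p-q≡0⇒p≡q (*≡0⇒≡0 0<p+1 [p-1][p+1]≡0))
    where
      0<p+1 : 0ℚ < p + 1ℚ
      0<p+1 = subst (_< p + 1ℚ) (+-identityˡ 0ℚ) (+-mono-≤-< 0≤p 0<1)
      [p-1][p+1]≡0 : (p - 1ℚ) * (p + 1ℚ) ≡ 0ℚ
      [p-1][p+1]≡0 = trans (solve 1 (λ p → (p :- con 1ℚ) :* (p :+ con 1ℚ) := p :* p :- con 1ℚ) refl p)
                           (trans (cong (_- 1ℚ) h) (+-inverseʳ 1ℚ))
  ... | no p≱0 = inj₂ (p-q≡0⇒p≡q (*≡0⇒≡0 0<1-p [p+1][1-p]≡0))
    where
      0<1-p : 0ℚ < 1ℚ - p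
      0<1-p = subst (_< 1ℚ - p) (+-identityʳ 0ℚ) (+-mono-<-≤ 0<1 (neg-antimono-≤ (<⇒≤ (≰⇒> p≱0))))
      [p+1][1-p]≡0 : (p - - 1ℚ) * (1ℚ - p) ≡ 0ℚ
      [p+1][1-p]≡0 = trans (solve 1 (λ p → (p :- (:- con 1ℚ)) :* (con 1ℚ :- p) := con 1ℚ :- p :* p) refl p)
                           (trans (cong (λ t → 1ℚ - t) h) (+-inverseʳ 1ℚ))

  ±1⇒square≡1 : ∀ {p} → p ≡ 1ℚ ⊎ p ≡ - 1ℚ → p * p ≡ 1ℚ
  ±1⇒square≡1 (inj₁ refl) = refl
  ±1⇒square≡1 (inj₂ refl) = refl

  +-cancelˡ-≤ : ∀ r {p q} → r + p ≤ r + q → p ≤ q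
  +-cancelˡ-≤ r {p} {q} h = subst₂ _≤_ (-r+[r+x]≡x p) (-r+[r+x]≡x q) (+-monoʳ-≤ (- r) h)
    where -r+[r+x]≡x : ∀ x → - r + (r + x) ≡ x
          -r+[r+x]≡x = solve 2 (λ r x → :- r :+ (r :+ x) := x) refl r

  p-0*p≡p : ∀ p → p - 0ℚ * p ≡ p
  p-0*p≡p = solve 1 (λ p → p :- con 0ℚ :* p := p) refl

  p-1*p≡0 : ∀ p → p - 1ℚ * p ≡ 0ℚ
  p-1*p≡0 p = trans (cong (λ t → p - t) (*-identityˡ p)) (+-inverseʳ p)

  s²≤O²≤1-tight : ∀ {O} s → 0ℚ < O → O ≤ 1ℚ → s * s ≤ O * O → s * s ≡ 1ℚ → O ≡ 1ℚ
  s²≤O²≤1-tight {O} s 0<O O≤1 s²≤O² s²≡1 = ≤-antisym O≤1 (≤-trans (subst (_≤ O * O) s²≡1 s²≤O²)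
    (subst (O * O ≤_) (*-identityʳ O) (*-monoˡ-≤-nonNeg O {{nonNegative (<⇒≤ 0<O)}} O≤1)))

  inv-inverseˡ : ∀ {p} → 0ℚ < p → inv p * p ≡ 1ℚ
  inv-inverseˡ {p} 0<p with p ≟ 0ℚ
  ... | yes p≡0 = ⊥-elim (<-irrefl (sym p≡0) 0<p)
  ... | no p≢0 = *-inverseˡ p {{≢-nonZero p≢0}}

  ℕtoℚ≡mkℚ : ∀ k → ℕtoℚ k ≡ mkℚ (ℤ.+ k) 0 (Coprime.sym (Coprime.1-coprimeTo k))
  ℕtoℚ≡mkℚ k = normalize-coprime (Coprime.sym (Coprime.1-coprimeTo k))

  ℕtoℚ-+ : ∀ a b → ℕtoℚ (a ℕ.+ b) ≡ ℕtoℚ a + ℕtoℚ b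
  ℕtoℚ-+ a b = toℚᵘ-injective (ℚᵘ.≃-trans ℚᵘ-+ (ℚᵘ.≃-sym (toℚᵘ-homo-+ (ℕtoℚ a) (ℕtoℚ b))))
    where
      ℚᵘ-+ : ℚ.toℚᵘ (ℕtoℚ (a ℕ.+ b)) ℚᵘ.≃ ℚ.toℚᵘ (ℕtoℚ a) ℚᵘ.+ ℚ.toℚᵘ (ℕtoℚ b)
      ℚᵘ-+ rewrite ℕtoℚ≡mkℚ (a ℕ.+ b) | ℕtoℚ≡mkℚ a | ℕtoℚ≡mkℚ b = ℚᵘ.*≡* (begin
          ℤ.+ (a ℕ.+ b) ℤ.* ℤ.+ 1                          ≡⟨ ℤ.*-identityʳ _ ⟩
          ℤ.+ (a ℕ.+ b)                                     ≡⟨ ℤ.pos-+ a b ⟨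
          ℤ.+ a ℤ.+ ℤ.+ b
            ≡⟨ cong₂ ℤ._+_ (ℤ.*-identityʳ (ℤ.+ a)) (ℤ.*-identityʳ (ℤ.+ b)) ⟨
          ℤ.+ a ℤ.* ℤ.+ 1 ℤ.+ ℤ.+ b ℤ.* ℤ.+ 1               ≡⟨ ℤ.*-identityʳ _ ⟨
          (ℤ.+ a ℤ.* ℤ.+ 1 ℤ.+ ℤ.+ b ℤ.* ℤ.+ 1) ℤ.* ℤ.+ 1  ∎)
        where open ≡-Reasoning

  ℕtoℚ-injective : ∀ {a b} → ℕtoℚ a ≡ ℕtoℚ b → a ≡ b
  ℕtoℚ-injective {a} {b} e =
    ℤ.+-injective (cong ℚ.numerator (trans (sym (ℕtoℚ≡mkℚ a)) (trans e (ℕtoℚ≡mkℚ b))))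

  ℕtoℚ-suc : ∀ k → ℕtoℚ (suc k) ≡ 1ℚ + ℕtoℚ k
  ℕtoℚ-suc = ℕtoℚ-+ 1

  ℕtoℚ-suc-drop : ∀ k → ℕtoℚ (suc k) - ℕtoℚ k ≡ 1ℚ
  ℕtoℚ-suc-drop k =
    trans (cong (_- ℕtoℚ k) (ℕtoℚ-suc k)) (solve 1 (λ x → con 1ℚ :+ x :- x := con 1ℚ) refl (ℕtoℚ k))

  ℕtoℚ-drop≡1 : ∀ {p q} → ℕtoℚ q - ℕtoℚ p ≡ 1ℚ → q ≡ suc p
  ℕtoℚ-drop≡1 {p} {q} h =
    ℕtoℚ-injective (trans (sym (q-p+p≡q (ℕtoℚ p) (ℕtoℚ q))) (trans (cong (_+ ℕtoℚ p) h) (sym (ℕtoℚ-suc p))))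

  ℕtoℚ-sumℕ : ∀ n (f : Fin n → ℕ) → ℕtoℚ (sumℕ n f) ≡ sumℚ n (λ x → ℕtoℚ (f x))
  ℕtoℚ-sumℕ zero f = refl
  ℕtoℚ-sumℕ (suc n) f = trans (ℕtoℚ-+ (f Fin.zero) _) (cong (ℕtoℚ (f Fin.zero) +_) (ℕtoℚ-sumℕ n _))

  bℚ-nonNeg : ∀ b → 0ℚ ≤ bℚ b
  bℚ-nonNeg true = *≤* (ℤ.+≤+ ℕ.z≤n)
  bℚ-nonNeg false = ≤-refl

  δ-refl : ∀ {n} (a : Fin n) → δ a a ≡ 1ℚ
  δ-refl a with a Fin.≟ a
  ... | yes _ = refl
  ... | no a≢a = ⊥-elim (a≢a refl)

  δ-≢ : ∀ {n} {a x : Fin n} → a ≢ x → δ a x ≡ 0ℚ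
  δ-≢ {a = a} {x} a≢x with a Fin.≟ x
  ... | yes a≡x = ⊥-elim (a≢x a≡x)
  ... | no _ = refl

  δ-nonNeg : ∀ {n} (a x : Fin n) → 0ℚ ≤ δ a x
  δ-nonNeg a x = bℚ-nonNeg _

  δ-* : ∀ {n} (a x : Fin n) (f : Fin n → ℚ) → δ a x * f x ≡ δ a x * f a
  δ-* a x f with a Fin.≟ x
  ... | yes refl = refl
  ... | no _ = trans (*-zeroˡ (f x)) (sym (*-zeroˡ (f a)))

  sumℚ-cong : ∀ n {f g : Fin n → ℚ} → (∀ x → f x ≡ g x) → sumℚ n f ≡ sumℚ n g
  sumℚ-cong zero f≗g = refl
  sumℚ-cong (suc n) f≗g = cong₂ _+_ (f≗g Fin.zero) (sumℚ-cong n (λ x → f≗g (Fin.suc x)))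

  sumℚ-0 : ∀ n → sumℚ n (λ _ → 0ℚ) ≡ 0ℚ
  sumℚ-0 zero = refl
  sumℚ-0 (suc n) = trans (+-identityˡ _) (sumℚ-0 n)

  sumℚ-+ : ∀ n (f g : Fin n → ℚ) → sumℚ n (λ x → f x + g x) ≡ sumℚ n f + sumℚ n g
  sumℚ-+ zero f g = refl
  sumℚ-+ (suc n) f g = trans (cong ((f Fin.zero + g Fin.zero) +_) (sumℚ-+ n _ _))
    (solve 4 (λ a b c d → (a :+ b) :+ (c :+ d) := (a :+ c) :+ (b :+ d)) refl
       (f Fin.zero) (g Fin.zero) (sumℚ n (λ x → f (Fin.suc x))) (sumℚ n (λ x → g (Fin.suc x))))

  sumℚ-*ˡ : ∀ n (c : ℚ) (f : Fin n → ℚ) → sumℚ n (λ x → c * f x) ≡ c * sumℚ n f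
  sumℚ-*ˡ zero c f = sym (*-zeroʳ c)
  sumℚ-*ˡ (suc n) c f = trans (cong (c * f Fin.zero +_) (sumℚ-*ˡ n c _)) (sym (*-distribˡ-+ c _ _))

  sumℚ-*ʳ : ∀ n (c : ℚ) (f : Fin n → ℚ) → sumℚ n (λ x → f x * c) ≡ sumℚ n f * c
  sumℚ-*ʳ n c f = trans (sumℚ-cong n (λ x → *-comm (f x) c)) (trans (sumℚ-*ˡ n c f) (*-comm c (sumℚ n f)))

  sumℚ-neg : ∀ n (f : Fin n → ℚ) → sumℚ n (λ x → - f x) ≡ - sumℚ n f
  sumℚ-neg zero f = refl
  sumℚ-neg (suc n) f =
    trans (cong (- f Fin.zero +_) (sumℚ-neg n _)) (sym (neg-distrib-+ (f Fin.zero) (sumℚ n (λ x → f (Fin.suc x)))))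

  sumℚ-- : ∀ n (f g : Fin n → ℚ) → sumℚ n (λ x → f x - g x) ≡ sumℚ n f - sumℚ n g
  sumℚ-- n f g = trans (sumℚ-+ n f (λ x → - g x)) (cong (sumℚ n f +_) (sumℚ-neg n g))

  sumℚ-comm : ∀ n m (f : Fin n → Fin m → ℚ) →
              sumℚ n (λ a → sumℚ m (f a)) ≡ sumℚ m (λ b → sumℚ n (λ a → f a b))
  sumℚ-comm zero m f = sym (sumℚ-0 m)
  sumℚ-comm (suc n) m f = trans (cong (sumℚ m (f Fin.zero) +_) (sumℚ-comm n m _))
    (sym (sumℚ-+ m (f Fin.zero) (λ b → sumℚ n (λ a → f (Fin.suc a) b))))

  sumℚ-δ : ∀ n (a : Fin n) (f : Fin n → ℚ) → sumℚ n (λ x → δ a x * f x) ≡ f a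
  sumℚ-δ (suc n) Fin.zero f = trans
    (cong₂ _+_ (*-identityˡ (f Fin.zero)) (trans (sumℚ-cong n (λ x → *-zeroˡ (f (Fin.suc x)))) (sumℚ-0 n)))
    (+-identityʳ (f Fin.zero))
  sumℚ-δ (suc n) (Fin.suc a) f = trans
    (cong₂ _+_ (*-zeroˡ (f Fin.zero)) (trans (sumℚ-cong n δ-suc) (sumℚ-δ n a (λ x → f (Fin.suc x)))))
    (+-identityˡ (f (Fin.suc a)))
    where
      δ-suc : ∀ x → δ (Fin.suc a) (Fin.suc x) * f (Fin.suc x) ≡ δ a x * f (Fin.suc x)
      δ-suc x with a Fin.≟ x
      ... | yes _ = refl
      ... | no _ = refl

  sumℚ-δʳ : ∀ n (a : Fin n) (f : Fin n → ℚ) → sumℚ n (λ x → f x * δ a x) ≡ f a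
  sumℚ-δʳ n a f = trans (sumℚ-cong n (λ x → *-comm (f x) (δ a x))) (sumℚ-δ n a f)

  sumℚ-δδ : ∀ n (h : Fin n → Fin n → ℚ) p q →
            sumℚ n (λ a → sumℚ n (λ b → δ p a * (δ q b * h a b))) ≡ h p q
  sumℚ-δδ n h p q = trans (sumℚ-cong n (λ a → trans (sumℚ-*ˡ n (δ p a) _) (cong (δ p a *_) (sumℚ-δ n q (h a)))))
                          (sumℚ-δ n p (λ a → h a q))

  sumℚ-+₃ : ∀ n (f g h : Fin n → ℚ) → sumℚ n (λ x → f x + g x + h x) ≡ sumℚ n f + sumℚ n g + sumℚ n h
  sumℚ-+₃ n f g h = trans (sumℚ-+ n (λ x → f x + g x) h) (cong (_+ sumℚ n h) (sumℚ-+ n f g))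

  sumℚ-nonNeg : ∀ n (f : Fin n → ℚ) → (∀ x → 0ℚ ≤ f x) → 0ℚ ≤ sumℚ n f
  sumℚ-nonNeg zero f 0≤f = ≤-refl
  sumℚ-nonNeg (suc n) f 0≤f = +-nonNeg (0≤f Fin.zero) (sumℚ-nonNeg n _ (λ x → 0≤f (Fin.suc x)))

  except : ∀ {n} → Fin n → (Fin n → ℚ) → Fin n → ℚ
  except y f x = f x - δ y x * f x

  except-≢ : ∀ {n} {y x : Fin n} (f : Fin n → ℚ) → y ≢ x → except y f x ≡ f x
  except-≢ {y = y} {x} f y≢x = trans (cong (λ d → f x - d * f x) (δ-≢ y≢x)) (p-0*p≡p (f x))

  except-nonNeg : ∀ {n} (y : Fin n) (f : Fin n → ℚ) → (∀ x → 0ℚ ≤ f x) → ∀ x → 0ℚ ≤ except y f x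
  except-nonNeg y f 0≤f x with y Fin.≟ x
  ... | yes _ = ≤-reflexive (sym (p-1*p≡0 (f x)))
  ... | no _ = subst (0ℚ ≤_) (sym (p-0*p≡p (f x))) (0≤f x)

  sumℚ-except : ∀ n (y : Fin n) (f : Fin n → ℚ) → sumℚ n f ≡ f y + sumℚ n (except y f)
  sumℚ-except n y f = begin
    sumℚ n f                                       ≡⟨ solve 2 (λ s p → s := p :+ (s :- p)) refl (sumℚ n f) (f y) ⟩
    f y + (sumℚ n f - f y)                         ≡⟨ cong (λ t → f y + (sumℚ n f - t)) (sumℚ-δ n y f) ⟨
    f y + (sumℚ n f - sumℚ n (λ x → δ y x * f x))  ≡⟨ cong (f y +_) (sumℚ-- n f _) ⟨
    f y + sumℚ n (except y f)                      ∎
    where open ≡-Reasoning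

  term≤sumℚ : ∀ {n} (f : Fin n → ℚ) → (∀ x → 0ℚ ≤ f x) → ∀ y → f y ≤ sumℚ n f
  term≤sumℚ {n} f 0≤f y = subst₂ _≤_ (+-identityʳ (f y)) (sym (sumℚ-except n y f))
    (+-monoʳ-≤ (f y) (sumℚ-nonNeg n _ (except-nonNeg y f 0≤f)))

  sumℚ≤0⇒≡0 : ∀ {n} (f : Fin n → ℚ) → (∀ x → 0ℚ ≤ f x) → sumℚ n f ≤ 0ℚ → ∀ x → f x ≡ 0ℚ
  sumℚ≤0⇒≡0 f 0≤f Σ≤0 x = ≤-antisym (≤-trans (term≤sumℚ f 0≤f x) Σ≤0) (0≤f x)

  sumℚ≤term⇒others≡0 : ∀ {n} (f : Fin n → ℚ) → (∀ x → 0ℚ ≤ f x) →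
                        ∀ {y} → sumℚ n f ≤ f y → ∀ x → y ≢ x → f x ≡ 0ℚ
  sumℚ≤term⇒others≡0 {n} f 0≤f {y} Σ≤fy x y≢x = trans (sym (except-≢ f y≢x))
    (sumℚ≤0⇒≡0 (except y f) (except-nonNeg y f 0≤f) Σrest≤0 x)
    where Σrest≤0 : sumℚ n (except y f) ≤ 0ℚ
          Σrest≤0 = +-cancelˡ-≤ (f y) (subst₂ _≤_ (sumℚ-except n y f) (sym (+-identityʳ (f y))) Σ≤fy)

  term+term≤sumℚ : ∀ {n} (f : Fin n → ℚ) → (∀ x → 0ℚ ≤ f x) →
                   ∀ {y z} → y ≢ z → f y + f z ≤ sumℚ n f
  term+term≤sumℚ {n} f 0≤f {y} {z} y≢z =
    subst₂ _≤_ (cong (f y +_) (except-≢ f y≢z)) (sym (sumℚ-except n y f))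
      (+-monoʳ-≤ (f y) (term≤sumℚ (except y f) (except-nonNeg y f 0≤f) z))

  sumℚ≤term+term⇒others≡0 : ∀ {n} (f : Fin n → ℚ) → (∀ x → 0ℚ ≤ f x) → ∀ {y z} → y ≢ z →
                             sumℚ n f ≤ f y + f z → ∀ x → y ≢ x → z ≢ x → f x ≡ 0ℚ
  sumℚ≤term+term⇒others≡0 {n} f 0≤f {y} {z} y≢z Σ≤ x y≢x z≢x = trans (sym (except-≢ f y≢x))
    (sumℚ≤term⇒others≡0 (except y f) (except-nonNeg y f 0≤f) Σrest≤ x z≢x)
    where Σrest≤ : sumℚ n (except y f) ≤ except y f z
          Σrest≤ = +-cancelˡ-≤ (f y)
            (subst₂ _≤_ (sumℚ-except n y f) (cong (f y +_) (sym (except-≢ f y≢z))) Σ≤)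

  sumℚ-support₁ : ∀ {n} (f : Fin n → ℚ) y → (∀ x → y ≢ x → f x ≡ 0ℚ) → sumℚ n f ≡ f y
  sumℚ-support₁ {n} f y f≡0 = trans (sumℚ-except n y f)
    (trans (cong (f y +_) (trans (sumℚ-cong n rest≡0) (sumℚ-0 n))) (+-identityʳ (f y)))
    where rest≡0 : ∀ x → except y f x ≡ 0ℚ
          rest≡0 x with y Fin.≟ x
          ... | yes _ = p-1*p≡0 (f x)
          ... | no y≢x = trans (p-0*p≡p (f x)) (f≡0 x y≢x)

  sumℚ-support₂ : ∀ {n} (f : Fin n → ℚ) {y z} → y ≢ z →
                  (∀ x → y ≢ x → z ≢ x → f x ≡ 0ℚ) → sumℚ n f ≡ f y + f z
  sumℚ-support₂ {n} f {y} {z} y≢z f≡0 = trans (sumℚ-except n y f)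
    (cong (f y +_) (trans (sumℚ-support₁ (except y f) z rest≡0) (except-≢ f y≢z)))
    where rest≡0 : ∀ x → z ≢ x → except y f x ≡ 0ℚ
          rest≡0 x z≢x with y Fin.≟ x
          ... | yes _ = p-1*p≡0 (f x)
          ... | no y≢x = trans (p-0*p≡p (f x)) (f≡0 x y≢x z≢x)

  module _ {n} (τ : Fin n → Fin n → ℚ) (τ-nonNeg : ∀ x y → 0ℚ ≤ τ x y) where

    private
      rowSum : Fin n → ℚ
      rowSum x = sumℚ n (τ x)

      rowSum-nonNeg : ∀ x → 0ℚ ≤ rowSum x
      rowSum-nonNeg x = sumℚ-nonNeg n (τ x) (τ-nonNeg x)

      1≤rowSum : ∀ {x y} → τ x y ≡ 1ℚ → 1ℚ ≤ rowSum x
      1≤rowSum {x} {y} τxy≡1 = subst (_≤ rowSum x) τxy≡1 (term≤sumℚ (τ x) (τ-nonNeg x) y)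

    sumℚ²≡1+1⇒others≡0 : ∀ {a b} → a ≢ b → τ a b ≡ 1ℚ → τ b a ≡ 1ℚ →
                          sumℚ n (λ x → sumℚ n (τ x)) ≡ 1ℚ + 1ℚ →
                          ∀ c d → a ≢ c → a ≢ d → τ c d ≡ 0ℚ
    sumℚ²≡1+1⇒others≡0 {a} {b} a≢b τab≡1 τba≡1 Σ≡2 c d a≢c a≢d with b Fin.≟ c
    ... | yes b≡c = subst (λ x → τ x d ≡ 0ℚ) b≡c (sumℚ≤term⇒others≡0 (τ b) (τ-nonNeg b) rowb≤τba d a≢d)
      where
        rowa+rowb≤2 : rowSum a + rowSum b ≤ 1ℚ + 1ℚ
        rowa+rowb≤2 = subst (rowSum a + rowSum b ≤_) Σ≡2 (term+term≤sumℚ rowSum rowSum-nonNeg a≢b)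
        rowb≤τba : rowSum b ≤ τ b a
        rowb≤τba = subst (rowSum b ≤_) (sym τba≡1)
          (+-cancelˡ-≤ 1ℚ (≤-trans (+-monoˡ-≤ (rowSum b) (1≤rowSum τab≡1)) rowa+rowb≤2))
    ... | no b≢c = sumℚ≤0⇒≡0 (τ c) (τ-nonNeg c) (≤-reflexive rowc≡0) d
      where
        rowc≡0 : rowSum c ≡ 0ℚ
        rowc≡0 = sumℚ≤term+term⇒others≡0 rowSum rowSum-nonNeg a≢b
          (subst (_≤ rowSum a + rowSum b) (sym Σ≡2) (+-mono-≤ (1≤rowSum τab≡1) (1≤rowSum τba≡1))) c a≢c b≢c

  -- Potentials and the maximum principle

  argmax : ∀ {n} → Fin n → (v : Fin n → ℚ) → Σ (Fin n) λ c → ∀ x → v x ≤ v c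
  argmax {suc zero} _ v = Fin.zero , λ { Fin.zero → ≤-refl }
  argmax {suc (suc n)} _ v with argmax {suc n} Fin.zero (λ x → v (Fin.suc x))
  ... | c , max with v (Fin.suc c) ≤? v Fin.zero
  ... | yes vc≤v0 = Fin.zero , λ { Fin.zero → ≤-refl ; (Fin.suc x) → ≤-trans (max x) vc≤v0 }
  ... | no vc≰v0 = Fin.suc c , λ { Fin.zero → <⇒≤ (≰⇒> vc≰v0) ; (Fin.suc x) → max x }

  record IsPotential {n} (A : Adj n) (a b : Fin n) (v : Fin n → ℚ) : Set where
    constructor kirchhoff
    field lap≡ : ∀ c → lap A v c ≡ δ a c - δ b c
  open IsPotential public

  effRes-potential : ∀ {n} (A : Adj n) {a b r} (e : IsEffRes A a b r) → IsPotential A a b (proj₁ e)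
  effRes-potential A (_ , lapv , _) = kirchhoff lapv

  module _ {n} (A : Adj n) where

    lap-- : ∀ (v w : Fin n → ℚ) c → lap A (λ x → v x - w x) c ≡ lap A v c - lap A w c
    lap-- v w c = trans (sumℚ-cong n (λ x →
        solve 5 (λ e vc vx wc wx → e :* ((vc :- wc) :- (vx :- wx)) := e :* (vc :- vx) :- e :* (wc :- wx)) refl
          (bℚ (A c x)) (v c) (v x) (w c) (w x)))
      (sumℚ-- n _ _)

    lap-*ˡ : ∀ (t : ℚ) (v : Fin n → ℚ) c → lap A (λ x → t * v x) c ≡ t * lap A v c
    lap-*ˡ t v c = trans (sumℚ-cong n (λ x →
        solve 4 (λ e t vc vx → e :* (t :* vc :- t :* vx) := t :* (e :* (vc :- vx))) refl (bℚ (A c x)) t (v c) (v x)))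
      (sumℚ-*ˡ n t _)

    lap-neg : ∀ (v : Fin n → ℚ) c → lap A (λ x → - v x) c ≡ - lap A v c
    lap-neg v c = trans (sumℚ-cong n (λ x →
        solve 3 (λ e vc vx → e :* ((:- vc) :- (:- vx)) := :- (e :* (vc :- vx))) refl (bℚ (A c x)) (v c) (v x)))
      (sumℚ-neg n _)

    potential-pairing : ∀ {a b v} → IsPotential A a b v → ∀ w → sumℚ n (λ c → lap A v c * w c) ≡ w a - w b
    potential-pairing {a} {b} {v} pot w = trans (sumℚ-cong n (λ c → trans (cong (_* w c) (lap≡ pot c))
        (solve 3 (λ x y z → (x :- y) :* z := z :* x :- z :* y) refl (δ a c) (δ b c) (w c))))
      (trans (sumℚ-- n _ _) (cong₂ _-_ (sumℚ-δʳ n a w) (sumℚ-δʳ n b w)))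

    dirichlet : (Fin n → ℚ) → (Fin n → ℚ) → ℚ
    dirichlet v w = sumℚ n λ a → sumℚ n λ b → bℚ (A a b) * ((v a - v b) * (w a - w b))

    module _ (symA : ∀ a b → A a b ≡ A b a) where

      green : ∀ v w → sumℚ n (λ c → lap A v c * w c) + sumℚ n (λ c → lap A v c * w c) ≡ dirichlet v w
      green v w = begin
        sumℚ n (λ c → lap A v c * w c) + sumℚ n (λ c → lap A v c * w c)
          ≡⟨ cong₂ _+_ pairing (trans pairing (sumℚ-comm n n F)) ⟩
        sumℚ n (λ a → sumℚ n (F a)) + sumℚ n (λ b → sumℚ n (λ a → F a b))
          ≡⟨ sym (sumℚ-+ n _ _) ⟩
        sumℚ n (λ a → sumℚ n (F a) + sumℚ n (λ b → F b a))
          ≡⟨ sumℚ-cong n (λ a → sym (sumℚ-+ n (F a) (λ b → F b a))) ⟩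
        sumℚ n (λ a → sumℚ n (λ b → F a b + F b a))
          ≡⟨ sumℚ-cong n (λ a → sumℚ-cong n (λ b → edge-terms a b)) ⟩
        dirichlet v w ∎
        where
          open ≡-Reasoning
          F : Fin n → Fin n → ℚ
          F c x = bℚ (A c x) * (v c - v x) * w c
          pairing : sumℚ n (λ c → lap A v c * w c) ≡ sumℚ n (λ c → sumℚ n (F c))
          pairing = sumℚ-cong n (λ c → sym (sumℚ-*ʳ n (w c) _))
          edge-terms : ∀ a b → F a b + F b a ≡ bℚ (A a b) * ((v a - v b) * (w a - w b))
          edge-terms a b = trans (cong (λ e → F a b + bℚ e * (v b - v a) * w b) (symA b a))
            (solve 5 (λ e va vb wa wb → e :* (va :- vb) :* wa :+ e :* (vb :- va) :* wb := e :* ((va :- vb) :* (wa :- wb)))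
               refl (bℚ (A a b)) (v a) (v b) (w a) (w b))

      lap-selfAdjoint : ∀ v w → sumℚ n (λ c → lap A v c * w c) ≡ sumℚ n (λ c → lap A w c * v c)
      lap-selfAdjoint v w = halve (trans (green v w) (trans (sumℚ-cong n (λ a → sumℚ-cong n (λ b →
          cong (bℚ (A a b) *_) (*-comm (v a - v b) (w a - w b))))) (sym (green w v))))
        where halve : ∀ {p q} → p + p ≡ q + q → p ≡ q
              halve {p} {q} h = trans (solve 1 (λ p → p := (p :+ p) :* con ½) refl p)
                                      (trans (cong (_* ½) h) (solve 1 (λ q → (q :+ q) :* con ½ := q) refl q))

      reciprocity : ∀ {a b c d v w} → IsPotential A a b v → IsPotential A c d w → v c - v d ≡ w a - w b
      reciprocity {v = v} {w} potv potw =
        trans (sym (potential-pairing potw v)) (trans (lap-selfAdjoint w v) (potential-pairing potv w))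

      dirichlet-potential : ∀ {a b v} → IsPotential A a b v → dirichlet v v ≡ (v a - v b) + (v a - v b)
      dirichlet-potential {v = v} pot = trans (sym (green v v)) (cong₂ _+_ (potential-pairing pot v) (potential-pairing pot v))

  potential-neg : ∀ {n} {A : Adj n} {a b v} → IsPotential A a b v → IsPotential A b a (λ x → - v x)
  potential-neg {A = A} {a} {b} {v} pot = kirchhoff λ c → trans (lap-neg A v c)
    (trans (cong -_ (lap≡ pot c)) (solve 2 (λ x y → :- (x :- y) := y :- x) refl (δ a c) (δ b c)))

  δ-≢-sub≤0 : ∀ {n} {a b c : Fin n} → a ≢ c → δ a c - δ b c ≤ 0ℚ
  δ-≢-sub≤0 {b = b} {c} a≢c rewrite δ-≢ a≢c =
    subst (_≤ 0ℚ) (sym (+-identityˡ (- δ b c))) (neg-antimono-≤ (δ-nonNeg b c))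

  lap-at-source : ∀ {n} {A : Adj n} {a b v} → a ≢ b → IsPotential A a b v → lap A v a ≡ 1ℚ
  lap-at-source {a = a} a≢b pot = trans (lap≡ pot a) (cong₂ _-_ (δ-refl a) (δ-≢ (λ b≡a → a≢b (sym b≡a))))

  module _ {n} {A : Adj n} where

    lap≤0-at-max : ∀ v c → (∀ x → v x ≤ v c) → lap A v c ≤ 0ℚ → ∀ y → A c y ≡ true → v y ≡ v c
    lap≤0-at-max v c max lap≤0 y Acy = sym (p-q≡0⇒p≡q (trans (sym (*-identityˡ _))
      (subst (λ e → bℚ e * (v c - v y) ≡ 0ℚ) Acy
        (sumℚ≤0⇒≡0 _ (λ x → *-nonNeg (bℚ-nonNeg (A c x)) (p≤q⇒0≤q-p (max x))) lap≤0 y))))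

    max-along-walk : ∀ v a → (∀ c → c ≢ a → lap A v c ≤ 0ℚ) →
                     ∀ {c} → Reach A c a → (∀ x → v x ≤ v c) → ∀ x → v x ≤ v a
    max-along-walk v a sub here max = max
    max-along-walk v a sub {c} (step {b = b} Acb walk) max with c Fin.≟ a
    ... | yes refl = max
    ... | no c≢a = max-along-walk v a sub walk
                     (λ x → subst (v x ≤_) (sym (lap≤0-at-max v c max (sub c c≢a) b Acb)) (max x))

  nonconstant-edge : ∀ {n} {A : Adj n} (f : Fin n → ℚ) {x y} → Reach A x y → f x ≢ f y →
                     Σ (Fin n) λ c → Σ (Fin n) λ d → A c d ≡ true × f c ≢ f d
  nonconstant-edge f here fx≢fx = ⊥-elim (fx≢fx refl)
  nonconstant-edge f {x} (step {b = b} Axb rest) fx≢fy with f x ≟ f b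
  ... | yes fx≡fb = nonconstant-edge f rest (λ fb≡fy → fx≢fy (trans fx≡fb fb≡fy))
  ... | no fx≢fb = x , b , Axb , fx≢fb

  module _ {n} {A : Adj n} (conn : Connected A) where

    subharmonic-max : ∀ v a → (∀ c → c ≢ a → lap A v c ≤ 0ℚ) → ∀ x → v x ≤ v a
    subharmonic-max v a sub = let (c , max) = argmax a v in max-along-walk v a sub (conn c a) max

    harmonic⇒constant : ∀ v → (∀ c → lap A v c ≡ 0ℚ) → ∀ a b → v a ≡ v b
    harmonic⇒constant v harm a b = ≤-antisym (subharmonic-max v b (λ c _ → ≤-reflexive (harm c)) a)
                                            (subharmonic-max v a (λ c _ → ≤-reflexive (harm c)) b)

    lap-injective-mod-constant : ∀ v w → (∀ c → lap A v c ≡ lap A w c) → ∀ a b → v a - v b ≡ w a - w b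
    lap-injective-mod-constant v w lapv≡lapw a b = begin
      v a - v b
        ≡⟨ solve 4 (λ va vb wa wb → va :- vb := (va :- wa) :- (vb :- wb) :+ (wa :- wb)) refl (v a) (v b) (w a) (w b) ⟩
      (v a - w a) - (v b - w b) + (w a - w b)
        ≡⟨ cong (λ t → t - (v b - w b) + (w a - w b)) (harmonic⇒constant (λ x → v x - w x) harm a b) ⟩
      (v b - w b) - (v b - w b) + (w a - w b)  ≡⟨ cong (_+ (w a - w b)) (+-inverseʳ (v b - w b)) ⟩
      0ℚ + (w a - w b)                         ≡⟨ +-identityˡ _ ⟩
      w a - w b                                ∎
      where
        open ≡-Reasoning
        harm : ∀ c → lap A (λ x → v x - w x) c ≡ 0ℚ
        harm c = trans (lap-- A v w c) (trans (cong (_- lap A w c) (lapv≡lapw c)) (+-inverseʳ (lap A w c)))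

    effRes-sym : ∀ {Ω} → IsResistance A Ω → ∀ a b → Ω b a ≡ Ω a b
    effRes-sym {Ω} res a b with res a b | res b a
    ... | v , lapv , Ωab≡ | w , lapw , Ωba≡ = begin
      Ω b a              ≡⟨ Ωba≡ ⟩
      w b - w a          ≡⟨ lap-injective-mod-constant w (λ x → - v x) lapw≡lap-v b a ⟩
      (- v b) - (- v a)  ≡⟨ solve 2 (λ x y → (:- y) :- (:- x) := x :- y) refl (v a) (v b) ⟩
      v a - v b          ≡⟨ Ωab≡ ⟨
      Ω a b              ∎
      where
        open ≡-Reasoning
        lapw≡lap-v : ∀ c → lap A w c ≡ lap A (λ x → - v x) c
        lapw≡lap-v c = trans (lapw c) (sym (lap≡ (potential-neg {A = A} {a} {b} {v} (kirchhoff lapv)) c))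

    potential≤source : ∀ {a b v} → IsPotential A a b v → ∀ x → v x ≤ v a
    potential≤source {a} {b} {v} pot =
      subharmonic-max v a (λ c c≢a → subst (_≤ 0ℚ) (sym (lap≡ pot c)) (δ-≢-sub≤0 (λ a≡c → c≢a (sym a≡c))))

    sink≤potential : ∀ {a b v} → IsPotential A a b v → ∀ x → v b ≤ v x
    sink≤potential {b = b} {v} pot x = subst₂ _≤_ (neg-involutive (v b)) (neg-involutive (v x))
      (neg-antimono-≤ (potential≤source (potential-neg pot) x))

    potential-drop-pos : ∀ {a b v} → a ≢ b → IsPotential A a b v → 0ℚ < v a - v b
    potential-drop-pos {a} {b} {v} a≢b pot with v b <? v a
    ... | yes vb<va = p<q⇒0<q-p vb<va
    ... | no vb≮va = ⊥-elim (<-irrefl (sym lap≡0) (subst (0ℚ <_) (sym (lap-at-source a≢b pot)) 0<1))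
      where
        flat : ∀ x → v a - v x ≡ 0ℚ
        flat x = trans
          (cong (_- v x) (≤-antisym (≤-trans (≮⇒≥ vb≮va) (sink≤potential pot x)) (potential≤source pot x)))
          (+-inverseʳ (v x))
        lap≡0 : lap A v a ≡ 0ℚ
        lap≡0 = trans (sumℚ-cong n (λ x → trans (cong (bℚ (A a x) *_) (flat x)) (*-zeroʳ (bℚ (A a x))))) (sumℚ-0 n)

    effRes-pos : ∀ {Ω} → IsResistance A Ω → ∀ {a b} → a ≢ b → 0ℚ < Ω a b
    effRes-pos res {a} {b} a≢b =
      subst (0ℚ <_) (sym (proj₂ (proj₂ (res a b)))) (potential-drop-pos a≢b (effRes-potential A (res a b)))

    potential-diff²≤drop² : ∀ {a b v} → IsPotential A a b v →
                            ∀ c d → (v c - v d) * (v c - v d) ≤ (v a - v b) * (v a - v b)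
    potential-diff²≤drop² {a} {b} {v} pot c d = 0≤q-p⇒p≤q (subst (0ℚ ≤_) difference-of-squares
        (*-nonNeg (p≤q⇒0≤q-p S≤O)
          (subst (0ℚ ≤_) (solve 2 (λ S O → S :- (:- O) := S :+ O) refl S O) (p≤q⇒0≤q-p -O≤S))))
      where
        S O : ℚ
        S = v c - v d
        O = v a - v b
        S≤O : S ≤ O
        S≤O = +-mono-≤ (potential≤source pot c) (neg-antimono-≤ (sink≤potential pot d))
        -O≤S : - O ≤ S
        -O≤S = subst (_≤ S) (solve 2 (λ x y → y :- x := :- (x :- y)) refl (v a) (v b))
                 (+-mono-≤ (sink≤potential pot c) (neg-antimono-≤ (potential≤source pot d)))
        difference-of-squares : (O - S) * (S + O) ≡ O * O - S * S
        difference-of-squares = solve 2 (λ S O → (O :- S) :* (S :+ O) := O :* O :- S :* S) refl S O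

    module _ (loopless : ∀ a → A a a ≡ false) where

      edge⇒≢ : ∀ {a b} → A a b ≡ true → a ≢ b
      edge⇒≢ {a} Aab refl with trans (sym Aab) (loopless a)
      ... | ()

      potential-drop-edge≤1 : ∀ {a b v} → A a b ≡ true → IsPotential A a b v → v a - v b ≤ 1ℚ
      potential-drop-edge≤1 {a} {b} {v} Aab pot = subst₂ _≤_ term≡ (lap-at-source (edge⇒≢ Aab) pot)
          (term≤sumℚ _ (λ x → *-nonNeg (bℚ-nonNeg (A a x)) (p≤q⇒0≤q-p (potential≤source pot x))) b)
        where term≡ : bℚ (A a b) * (v a - v b) ≡ v a - v b
              term≡ = trans (cong (λ e → bℚ e * (v a - v b)) Aab) (*-identityˡ _)

      effRes-edge≤1 : ∀ {Ω} → IsResistance A Ω → ∀ {a b} → A a b ≡ true → Ω a b ≤ 1ℚ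
      effRes-edge≤1 res {a} {b} Aab =
        subst (_≤ 1ℚ) (sym (proj₂ (proj₂ (res a b))))
          (potential-drop-edge≤1 Aab (effRes-potential A (res a b)))

      -- An edge of unit effective resistance carries all the energy of its own unit flow.
      unit-edge-isolated : (∀ a b → A a b ≡ A b a) → ∀ {a b v} → A a b ≡ true → IsPotential A a b v →
                           v a - v b ≡ 1ℚ → ∀ c d → A c d ≡ true → a ≢ c → a ≢ d → v c ≡ v d
      unit-edge-isolated symA {a} {b} {v} Aab pot drop≡1 c d Acd a≢c a≢d =
        p-q≡0⇒p≡q (square≡0⇒≡0 (v c - v d) (trans (sym (energy-edge Acd))
          (sumℚ²≡1+1⇒others≡0 τ τ-nonNeg (edge⇒≢ Aab) τab≡1 τba≡1 Στ≡2 c d a≢c a≢d)))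
        where
          τ : Fin n → Fin n → ℚ
          τ x y = bℚ (A x y) * ((v x - v y) * (v x - v y))
          τ-nonNeg : ∀ x y → 0ℚ ≤ τ x y
          τ-nonNeg x y = *-nonNeg (bℚ-nonNeg (A x y)) (square-nonNeg (v x - v y))
          energy-edge : ∀ {x y} → A x y ≡ true → τ x y ≡ (v x - v y) * (v x - v y)
          energy-edge {x} {y} Axy = trans (cong (λ e → bℚ e * ((v x - v y) * (v x - v y))) Axy) (*-identityˡ _)
          Στ≡2 : sumℚ n (λ x → sumℚ n (τ x)) ≡ 1ℚ + 1ℚ
          Στ≡2 = trans (dirichlet-potential A symA pot) (cong₂ _+_ drop≡1 drop≡1)
          τab≡1 : τ a b ≡ 1ℚ
          τab≡1 = trans (energy-edge Aab) (cong₂ _*_ drop≡1 drop≡1)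
          τba≡1 : τ b a ≡ 1ℚ
          τba≡1 = trans (energy-edge (trans (symA b a) Aab))
            (trans (solve 2 (λ x y → (y :- x) :* (y :- x) := (x :- y) :* (x :- y)) refl (v a) (v b))
              (cong₂ _*_ drop≡1 drop≡1))

  -- Adding an edge

  bℚ-∧ : ∀ x y → bℚ (x ∧ y) ≡ bℚ x * bℚ y
  bℚ-∧ true y = sym (*-identityˡ (bℚ y))
  bℚ-∧ false y = sym (*-zeroˡ (bℚ y))

  bℚ-∨ : ∀ x y → (x ≡ true → y ≡ false) → bℚ (x ∨ y) ≡ bℚ x + bℚ y
  bℚ-∨ true true disjoint with disjoint refl
  ... | ()
  bℚ-∨ true false _ = refl
  bℚ-∨ false y _ = sym (+-identityˡ (bℚ y))

  if-then-0≡bℚ-* : ∀ b x → (if b then x else 0ℚ) ≡ bℚ b * x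
  if-then-0≡bℚ-* true x = sym (*-identityˡ x)
  if-then-0≡bℚ-* false x = sym (*-zeroˡ x)

  ∨≡true : ∀ {x y} → x ∨ y ≡ true → x ≡ true ⊎ y ≡ true
  ∨≡true {true} _ = inj₁ refl
  ∨≡true {false} y≡true = inj₂ y≡true

  ⌊≟⌋∧⌊≟⌋≡true : ∀ {n} {c x i j : Fin n} →
                 ⌊ c Fin.≟ i ⌋ ∧ ⌊ x Fin.≟ j ⌋ ≡ true → c ≡ i × x ≡ j
  ⌊≟⌋∧⌊≟⌋≡true {c = c} {x} {i} {j} h with c Fin.≟ i | x Fin.≟ j | h
  ... | yes c≡i | yes x≡j | _ = c≡i , x≡j
  ... | yes _ | no _ | ()
  ... | no _ | _ | ()

  δ≡bℚ⌊≟⌋ : ∀ {n} (a c : Fin n) → δ a c ≡ bℚ ⌊ c Fin.≟ a ⌋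
  δ≡bℚ⌊≟⌋ a c with a Fin.≟ c | c Fin.≟ a
  ... | yes _ | yes _ = refl
  ... | no _ | no _ = refl
  ... | yes a≡c | no c≢a = ⊥-elim (c≢a (sym a≡c))
  ... | no a≢c | yes c≡a = ⊥-elim (a≢c (sym c≡a))

  module _ {n} (A : Adj n) (i j : Fin n) where

    addEdge-connected : Connected A → Connected (addEdge A i j)
    addEdge-connected conn a b = walk (conn a b)
      where walk : ∀ {a b} → Reach A a b → Reach (addEdge A i j) a b
            walk here = here
            walk (step Aab rest) = step (cong (_∨ _) Aab) (walk rest)

    module _ (i≢j : i ≢ j) (Aij≡false : A i j ≡ false) (Aji≡false : A j i ≡ false) where

      bℚ-addEdge : ∀ c x → bℚ (addEdge A i j c x) ≡ bℚ (A c x) + δ i c * δ j x + δ j c * δ i x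
      bℚ-addEdge c x = begin
        bℚ (A c x ∨ (new i j ∨ new j i))                 ≡⟨ bℚ-∨ (A c x) _ old⇒¬new ⟩
        bℚ (A c x) + bℚ (new i j ∨ new j i)              ≡⟨ cong (bℚ (A c x) +_) (bℚ-∨ (new i j) _ ij⇒¬ji) ⟩
        bℚ (A c x) + (bℚ (new i j) + bℚ (new j i))
          ≡⟨ cong (λ t → bℚ (A c x) + t) (cong₂ _+_ (δδ i j) (δδ j i)) ⟩
        bℚ (A c x) + (δ i c * δ j x + δ j c * δ i x)     ≡⟨ +-assoc (bℚ (A c x)) _ _ ⟨
        bℚ (A c x) + δ i c * δ j x + δ j c * δ i x       ∎
        where
          open ≡-Reasoning
          new : Fin n → Fin n → Bool
          new p q = ⌊ c Fin.≟ p ⌋ ∧ ⌊ x Fin.≟ q ⌋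
          δδ : ∀ p q → bℚ (new p q) ≡ δ p c * δ q x
          δδ p q = trans (bℚ-∧ ⌊ c Fin.≟ p ⌋ _) (sym (cong₂ _*_ (δ≡bℚ⌊≟⌋ p c) (δ≡bℚ⌊≟⌋ q x)))
          ij⇒¬ji : new i j ≡ true → new j i ≡ false
          ij⇒¬ji newij = Bool.¬-not λ newji →
            i≢j (trans (sym (proj₁ (⌊≟⌋∧⌊≟⌋≡true {c = c} {x} newij)))
                       (proj₁ (⌊≟⌋∧⌊≟⌋≡true {c = c} {x} newji)))
          old⇒¬new : A c x ≡ true → new i j ∨ new j i ≡ false
          old⇒¬new Acx≡true = Bool.¬-not λ new≡true →
            [ hits Aij≡false , hits Aji≡false ]′ (∨≡true new≡true)
            where
              hits : ∀ {p q} → A p q ≡ false → new p q ≡ true → ⊥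
              hits {p} {q} Apq≡false newpq with ⌊≟⌋∧⌊≟⌋≡true {c = c} {x} {p} {q} newpq
              ... | c≡p , x≡q with trans (sym Acx≡true) (trans (cong₂ A c≡p x≡q) Apq≡false)
              ... | ()

      lap-addEdge : ∀ w c → lap (addEdge A i j) w c ≡ lap A w c + (δ i c - δ j c) * (w i - w j)
      lap-addEdge w c = begin
        sumℚ n (λ x → bℚ (addEdge A i j c x) * (w c - w x))
          ≡⟨ sumℚ-cong n (λ x → trans (cong (_* (w c - w x)) (bℚ-addEdge c x))
               (solve 6 (λ e p q r s d → (e :+ p :* q :+ r :* s) :* d := e :* d :+ p :* (q :* d) :+ r :* (s :* d)) refl
                 (bℚ (A c x)) (δ i c) (δ j x) (δ j c) (δ i x) (w c - w x))) ⟩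
        sumℚ n (λ x → bℚ (A c x) * (w c - w x) + δ i c * (δ j x * (w c - w x)) + δ j c * (δ i x * (w c - w x)))
          ≡⟨ trans (sumℚ-+ n _ _) (cong (_+ _) (sumℚ-+ n _ _)) ⟩
        lap A w c + sumℚ n (λ x → δ i c * (δ j x * (w c - w x))) + sumℚ n (λ x → δ j c * (δ i x * (w c - w x)))
          ≡⟨ cong₂ (λ p q → lap A w c + p + q)
               (trans (sumℚ-*ˡ n (δ i c) _) (cong (δ i c *_) (sumℚ-δ n j (λ x → w c - w x))))
               (trans (sumℚ-*ˡ n (δ j c) _) (cong (δ j c *_) (sumℚ-δ n i (λ x → w c - w x)))) ⟩
        lap A w c + δ i c * (w c - w j) + δ j c * (w c - w i)
          ≡⟨ cong₂ (λ p q → lap A w c + p + q) (δ-* i c (λ y → w y - w j)) (δ-* j c (λ y → w y - w i)) ⟩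
        lap A w c + δ i c * (w i - w j) + δ j c * (w j - w i)
          ≡⟨ solve 5 (λ L p q wi wj → L :+ p :* (wi :- wj) :+ q :* (wj :- wi) := L :+ (p :- q) :* (wi :- wj)) refl
               (lap A w c) (δ i c) (δ j c) (w i) (w j) ⟩
        lap A w c + (δ i c - δ j c) * (w i - w j) ∎
        where open ≡-Reasoning

  _<ᵇ_ : ∀ {n} → Fin n → Fin n → Bool
  a <ᵇ b = toℕ a ℕ.<ᵇ toℕ b

  <ᵇ-exclusive : ∀ {n} {a b : Fin n} → a ≢ b → bℚ (a <ᵇ b) + bℚ (b <ᵇ a) ≡ 1ℚ
  <ᵇ-exclusive {a = a} {b} a≢b
    with toℕ a ℕ.<ᵇ toℕ b | ℕ.<ᵇ-reflects-< (toℕ a) (toℕ b)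
       | toℕ b ℕ.<ᵇ toℕ a | ℕ.<ᵇ-reflects-< (toℕ b) (toℕ a)
  ... | true | ofʸ a<b | true | ofʸ b<a = ⊥-elim (ℕ.<-asym a<b b<a)
  ... | true | _ | false | _ = refl
  ... | false | _ | true | _ = refl
  ... | false | ofⁿ a≮b | false | ofⁿ b≮a with ℕ.<-cmp (toℕ a) (toℕ b)
  ...   | tri< a<b _ _ = ⊥-elim (a≮b a<b)
  ...   | tri≈ _ a≡b _ = ⊥-elim (a≢b (Fin.toℕ-injective a≡b))
  ...   | tri> _ _ b<a = ⊥-elim (b≮a b<a)

  <ᵇ-total : ∀ {n} {a b : Fin n} → a ≢ b → a <ᵇ b ≡ true ⊎ b <ᵇ a ≡ true
  <ᵇ-total {a = a} {b} a≢b with a <ᵇ b | b <ᵇ a | <ᵇ-exclusive a≢b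
  ... | true | _ | _ = inj₁ refl
  ... | false | true | _ = inj₂ refl
  ... | false | false | 0≡1 = ⊥-elim (<-irrefl 0≡1 0<1)

  module _ {n} (A : Adj n) where

    edgeSumℚ-cong : ∀ {f g} → (∀ a b → A a b ≡ true → f a b ≡ g a b) → edgeSumℚ A f ≡ edgeSumℚ A g
    edgeSumℚ-cong {f} {g} f≗g = sumℚ-cong n λ a → sumℚ-cong n λ b → term (a <ᵇ b) (A a b) (f≗g a b)
      where term : ∀ l e {x y} → (e ≡ true → x ≡ y) → (if l ∧ e then x else 0ℚ) ≡ (if l ∧ e then y else 0ℚ)
            term true true x≡y = x≡y refl
            term true false _ = refl
            term false _ _ = refl

    edgeSumℚ-- : ∀ f g → edgeSumℚ A (λ a b → f a b - g a b) ≡ edgeSumℚ A f - edgeSumℚ A g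
    edgeSumℚ-- f g =
      trans (sumℚ-cong n (λ a → trans (sumℚ-cong n (λ b → term (a <ᵇ b ∧ A a b))) (sumℚ-- n _ _)))
                           (sumℚ-- n _ _)
      where term : ∀ c {x y} → (if c then x - y else 0ℚ) ≡ (if c then x else 0ℚ) - (if c then y else 0ℚ)
            term true = refl
            term false = sym (+-inverseʳ 0ℚ)

    edgeSumℚ-const : ∀ k → edgeSumℚ A (λ _ _ → k) ≡ ℕtoℚ (numEdges A) * k
    edgeSumℚ-const k = begin
      sumℚ n (λ a → sumℚ n (λ b → if a <ᵇ b ∧ A a b then k else 0ℚ))
        ≡⟨ sumℚ-cong n (λ a → sumℚ-cong n (λ b → term (a <ᵇ b ∧ A a b))) ⟩
      sumℚ n (λ a → sumℚ n (λ b → ℕtoℚ (count a b) * k))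
        ≡⟨ sumℚ-cong n (λ a → sumℚ-*ʳ n k _) ⟩
      sumℚ n (λ a → sumℚ n (λ b → ℕtoℚ (count a b)) * k)
        ≡⟨ sumℚ-*ʳ n k _ ⟩
      sumℚ n (λ a → sumℚ n (λ b → ℕtoℚ (count a b))) * k
        ≡⟨ cong (_* k) (trans (sumℚ-cong n (λ a → sym (ℕtoℚ-sumℕ n (count a)))) (sym (ℕtoℚ-sumℕ n _))) ⟩
      ℕtoℚ (numEdges A) * k ∎
      where
        open ≡-Reasoning
        count : Fin n → Fin n → ℕ
        count a b = if a <ᵇ b ∧ A a b then 1 else 0
        term : ∀ c → (if c then k else 0ℚ) ≡ ℕtoℚ (if c then 1 else 0) * k
        term true = sym (*-identityˡ k)
        term false = sym (*-zeroˡ k)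

    module _ {f : Fin n → Fin n → ℚ} (0≤f : ∀ a b → A a b ≡ true → 0ℚ ≤ f a b) where

      private
        term : Fin n → Fin n → ℚ
        term a b = if a <ᵇ b ∧ A a b then f a b else 0ℚ

        term-nonNeg : ∀ a b → 0ℚ ≤ term a b
        term-nonNeg a b with a <ᵇ b | A a b in Aab
        ... | true | true = 0≤f a b Aab
        ... | true | false = ≤-refl
        ... | false | _ = ≤-refl

        row-nonNeg : ∀ a → 0ℚ ≤ sumℚ n (term a)
        row-nonNeg a = sumℚ-nonNeg n (term a) (term-nonNeg a)

        term≡ : ∀ {a b} → a <ᵇ b ≡ true → A a b ≡ true → term a b ≡ f a b
        term≡ a<b Aab rewrite a<b | Aab = refl

      edgeSumℚ-nonNeg : 0ℚ ≤ edgeSumℚ A f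
      edgeSumℚ-nonNeg = sumℚ-nonNeg n _ row-nonNeg

      edgeSumℚ-pos : ∀ {a b} → a <ᵇ b ≡ true → A a b ≡ true → 0ℚ < f a b → 0ℚ < edgeSumℚ A f
      edgeSumℚ-pos {a} {b} a<b Aab 0<fab = <-≤-trans (subst (0ℚ <_) (sym (term≡ a<b Aab)) 0<fab)
        (≤-trans (term≤sumℚ (term a) (term-nonNeg a) b) (term≤sumℚ _ row-nonNeg a))

      edgeSumℚ≤0⇒≡0 : edgeSumℚ A f ≤ 0ℚ → ∀ {a b} → a <ᵇ b ≡ true → A a b ≡ true → f a b ≡ 0ℚ
      edgeSumℚ≤0⇒≡0 Σ≤0 {a} {b} a<b Aab = trans (sym (term≡ a<b Aab))
        (sumℚ≤0⇒≡0 (term a) (term-nonNeg a) (≤-reflexive (sumℚ≤0⇒≡0 _ row-nonNeg Σ≤0 a)) b)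

    module _ {i j : Fin n} (i≢j : i ≢ j) (Aij≡false : A i j ≡ false) (Aji≡false : A j i ≡ false) where

      edgeSumℚ-addEdge : ∀ f → f j i ≡ f i j → edgeSumℚ (addEdge A i j) f ≡ edgeSumℚ A f + f i j
      edgeSumℚ-addEdge f fji≡fij = begin
        edgeSumℚ (addEdge A i j) f                                          ≡⟨ oriented (addEdge A i j) ⟩
        sumℚ n (λ a → sumℚ n (λ b → bℚ (a <ᵇ b) * (bℚ (addEdge A i j a b) * f a b)))
          ≡⟨ sumℚ-cong n (λ a → sumℚ-cong n (split a)) ⟩
        sumℚ n (λ a → sumℚ n (λ b → E a b + P a b + Q a b))
          ≡⟨ trans (sumℚ-cong n (λ a → sumℚ-+₃ n (E a) (P a) (Q a)))
                   (sumℚ-+₃ n (λ a → sumℚ n (E a)) (λ a → sumℚ n (P a)) (λ a → sumℚ n (Q a))) ⟩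
        sumℚ n (λ a → sumℚ n (E a)) + sumℚ n (λ a → sumℚ n (P a)) + sumℚ n (λ a → sumℚ n (Q a))
          ≡⟨ cong₂ _+_ (cong₂ _+_ (sym (oriented A)) (sumℚ-δδ n g i j)) (sumℚ-δδ n g j i) ⟩
        edgeSumℚ A f + g i j + g j i                                        ≡⟨ +-assoc (edgeSumℚ A f) (g i j) (g j i) ⟩
        edgeSumℚ A f + (g i j + g j i)                                      ≡⟨ cong (edgeSumℚ A f +_) new-edge ⟩
        edgeSumℚ A f + f i j                                                ∎
        where
          open ≡-Reasoning
          g E P Q : Fin n → Fin n → ℚ
          g a b = bℚ (a <ᵇ b) * f a b
          E a b = bℚ (a <ᵇ b) * (bℚ (A a b) * f a b)
          P a b = δ i a * (δ j b * g a b)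
          Q a b = δ j a * (δ i b * g a b)
          oriented : ∀ B → edgeSumℚ B f ≡ sumℚ n (λ a → sumℚ n (λ b → bℚ (a <ᵇ b) * (bℚ (B a b) * f a b)))
          oriented B = sumℚ-cong n λ a → sumℚ-cong n λ b → trans (if-then-0≡bℚ-* (a <ᵇ b ∧ B a b) (f a b))
            (trans (cong (_* f a b) (bℚ-∧ (a <ᵇ b) (B a b))) (*-assoc (bℚ (a <ᵇ b)) (bℚ (B a b)) (f a b)))
          split : ∀ a b → bℚ (a <ᵇ b) * (bℚ (addEdge A i j a b) * f a b) ≡ E a b + P a b + Q a b
          split a b = trans (cong (λ e → bℚ (a <ᵇ b) * (e * f a b)) (bℚ-addEdge A i j i≢j Aij≡false Aji≡false a b))
            (solve 7 (λ l e p q r s x → l :* ((e :+ p :* q :+ r :* s) :* x)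
                                        := l :* (e :* x) :+ p :* (q :* (l :* x)) :+ r :* (s :* (l :* x)))
              refl (bℚ (a <ᵇ b)) (bℚ (A a b)) (δ i a) (δ j b) (δ j a) (δ i b) (f a b))
          new-edge : g i j + g j i ≡ f i j
          new-edge = begin
            bℚ (i <ᵇ j) * f i j + bℚ (j <ᵇ i) * f j i
              ≡⟨ cong (λ t → bℚ (i <ᵇ j) * f i j + bℚ (j <ᵇ i) * t) fji≡fij ⟩
            bℚ (i <ᵇ j) * f i j + bℚ (j <ᵇ i) * f i j ≡⟨ *-distribʳ-+ (f i j) (bℚ (i <ᵇ j)) (bℚ (j <ᵇ i)) ⟨
            (bℚ (i <ᵇ j) + bℚ (j <ᵇ i)) * f i j       ≡⟨ cong (_* f i j) (<ᵇ-exclusive i≢j) ⟩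
            1ℚ * f i j                                 ≡⟨ *-identityˡ (f i j) ⟩
            f i j                                      ∎

    edgeSumℚ-mono-≤ : ∀ {f g} → (∀ a b → A a b ≡ true → f a b ≤ g a b) → edgeSumℚ A f ≤ edgeSumℚ A g
    edgeSumℚ-mono-≤ {f} {g} f≤g = 0≤q-p⇒p≤q (subst (0ℚ ≤_) (edgeSumℚ-- g f)
      (edgeSumℚ-nonNeg {λ a b → g a b - f a b} (λ a b Aab → p≤q⇒0≤q-p (f≤g a b Aab))))

  -- Per-edge arithmetic: O and O⁺ are the resistances of an edge before and after adding ij, s the flow across it.
  module ReciprocalIncrement (O O⁺ s R : ℚ) (0<O : 0ℚ < O) (O≤1 : O ≤ 1ℚ) (s²≤O² : s * s ≤ O * O)
           (0<R : 0ℚ < R) (0<O⁺ : 0ℚ < O⁺) (update : (1ℚ + R) * O⁺ ≡ (1ℚ + R) * O - s * s) where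

    private
      D : ℚ
      D = 1ℚ + R
      0<D : 0ℚ < D
      0<D = subst (_< D) (+-identityʳ 0ℚ) (+-mono-<-≤ 0<1 (<⇒≤ 0<R))
      X Y Z : ℚ
      X = inv O⁺
      Y = inv O
      Z = inv R

      increment-scaled : (X - Y) * (O⁺ * O * D) ≡ s * s
      increment-scaled = begin
        (X - Y) * (O⁺ * O * D)
          ≡⟨ solve 5 (λ X Y O⁺ O D → (X :- Y) :* (O⁺ :* O :* D) := (X :* O⁺) :* (O :* D) :- (Y :* O) :* (D :* O⁺))
               refl X Y O⁺ O D ⟩
        (X * O⁺) * (O * D) - (Y * O) * (D * O⁺)
          ≡⟨ cong₂ (λ p q → p * (O * D) - q * (D * O⁺)) (inv-inverseˡ 0<O⁺) (inv-inverseˡ 0<O) ⟩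
        1ℚ * (O * D) - 1ℚ * (D * O⁺)                  ≡⟨ cong (λ t → 1ℚ * (O * D) - 1ℚ * t) update ⟩
        1ℚ * (O * D) - 1ℚ * (D * O - s * s)
          ≡⟨ solve 3 (λ O D s → con 1ℚ :* (O :* D) :- con 1ℚ :* (D :* O :- s :* s) := s :* s) refl O D s ⟩
        s * s                                          ∎
        where open ≡-Reasoning

      -- the slack Q splits into two visibly nonnegative parts
      Q : ℚ
      Q = (O * O - s * s) * (O + R) + O * O * (1ℚ - O)

      slack-scaled : (Z - (X - Y)) * (O⁺ * O * R * D) ≡ Q
      slack-scaled = begin
        (Z - (X - Y)) * (O⁺ * O * R * D)
          ≡⟨ solve 7 (λ X Y Z O⁺ O R D → (Z :- (X :- Y)) :* (O⁺ :* O :* R :* D)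
                       := (Z :* R) :* (O⁺ :* O :* D) :- (X :* O⁺) :* (O :* R :* D) :+ (Y :* O) :* (O⁺ :* R :* D))
               refl X Y Z O⁺ O R D ⟩
        (Z * R) * (O⁺ * O * D) - (X * O⁺) * (O * R * D) + (Y * O) * (O⁺ * R * D)
          ≡⟨ cong₂ (λ p q → p * (O⁺ * O * D) - q * (O * R * D) + (Y * O) * (O⁺ * R * D))
                   (inv-inverseˡ 0<R) (inv-inverseˡ 0<O⁺) ⟩
        1ℚ * (O⁺ * O * D) - 1ℚ * (O * R * D) + (Y * O) * (O⁺ * R * D)
          ≡⟨ cong (λ q → 1ℚ * (O⁺ * O * D) - 1ℚ * (O * R * D) + q * (O⁺ * R * D)) (inv-inverseˡ 0<O) ⟩
        1ℚ * (O⁺ * O * D) - 1ℚ * (O * R * D) + 1ℚ * (O⁺ * R * D)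
          ≡⟨ solve 4 (λ O⁺ O R D → con 1ℚ :* (O⁺ :* O :* D) :- con 1ℚ :* (O :* R :* D) :+ con 1ℚ :* (O⁺ :* R :* D)
                                   := (D :* O⁺) :* (O :+ R) :- O :* R :* D) refl O⁺ O R D ⟩
        (D * O⁺) * (O + R) - O * R * D
          ≡⟨ cong (λ t → t * (O + R) - O * R * D) update ⟩
        (D * O - s * s) * (O + R) - O * R * D
          ≡⟨ solve 3 (λ O s R → ((con 1ℚ :+ R) :* O :- s :* s) :* (O :+ R) :- O :* R :* (con 1ℚ :+ R)
                       := (O :* O :- s :* s) :* (O :+ R) :+ O :* O :* (con 1ℚ :- O)) refl O s R ⟩
        Q ∎
        where open ≡-Reasoning

      0<O⁺OD : 0ℚ < O⁺ * O * D
      0<O⁺OD = *-pos (*-pos 0<O⁺ 0<O) 0<D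

      0<O⁺ORD : 0ℚ < O⁺ * O * R * D
      0<O⁺ORD = *-pos (*-pos (*-pos 0<O⁺ 0<O) 0<R) 0<D

      0<O+R : 0ℚ < O + R
      0<O+R = subst (_< O + R) (+-identityʳ 0ℚ) (+-mono-< 0<O 0<R)

      Q₁-nonNeg : 0ℚ ≤ (O * O - s * s) * (O + R)
      Q₁-nonNeg = *-nonNeg (p≤q⇒0≤q-p s²≤O²) (<⇒≤ 0<O+R)

      Q₂-nonNeg : 0ℚ ≤ O * O * (1ℚ - O)
      Q₂-nonNeg = *-nonNeg (square-nonNeg O) (p≤q⇒0≤q-p O≤1)

    increment-nonNeg : 0ℚ ≤ inv O⁺ - inv O
    increment-nonNeg = *-cancelʳ-nonNeg 0<O⁺OD (subst (0ℚ ≤_) (sym increment-scaled) (square-nonNeg s))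

    increment-pos : s ≢ 0ℚ → 0ℚ < inv O⁺ - inv O
    increment-pos s≢0 = *-cancelʳ-pos 0<O⁺OD (subst (0ℚ <_) (sym increment-scaled) (square-pos s≢0))

    increment≤inv : inv O⁺ - inv O ≤ inv R
    increment≤inv =
      0≤q-p⇒p≤q (*-cancelʳ-nonNeg 0<O⁺ORD (subst (0ℚ ≤_) (sym slack-scaled) (+-nonNeg Q₁-nonNeg Q₂-nonNeg)))

    increment≡inv⇔s²≡1 : (inv O⁺ - inv O ≡ inv R) ⇔ (s * s ≡ 1ℚ)
    increment≡inv⇔s²≡1 = mk⇔ to from
      where
        to : X - Y ≡ Z → s * s ≡ 1ℚ
        to X-Y≡Z = trans (sym (p-q≡0⇒p≡q (*≡0⇒≡0 0<O+R Q₁≡0))) (cong₂ _*_ O≡1 O≡1)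
          where
            Q≡0 : Q ≡ 0ℚ
            Q≡0 = trans (sym slack-scaled) (trans (cong (λ t → (Z - t) * (O⁺ * O * R * D)) X-Y≡Z)
              (trans (cong (_* (O⁺ * O * R * D)) (+-inverseʳ Z)) (*-zeroˡ (O⁺ * O * R * D))))
            Q₁≡0 : (O * O - s * s) * (O + R) ≡ 0ℚ
            Q₁≡0 = nonNeg+nonNeg≡0⇒≡0 Q₁-nonNeg Q₂-nonNeg Q≡0
            Q₂≡0 : O * O * (1ℚ - O) ≡ 0ℚ
            Q₂≡0 = nonNeg+nonNeg≡0⇒≡0 Q₂-nonNeg Q₁-nonNeg
                     (trans (+-comm (O * O * (1ℚ - O)) ((O * O - s * s) * (O + R))) Q≡0)
            O≡1 : O ≡ 1ℚ
            O≡1 = sym (p-q≡0⇒p≡q (*≡0⇒≡0 (*-pos 0<O 0<O) (trans (*-comm (1ℚ - O) (O * O)) Q₂≡0)))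
        from : s * s ≡ 1ℚ → X - Y ≡ Z
        from s²≡1 = sym (p-q≡0⇒p≡q (*≡0⇒≡0 0<O⁺ORD (trans slack-scaled Q≡0)))
          where
            O≡1 : O ≡ 1ℚ
            O≡1 = s²≤O²≤1-tight s 0<O O≤1 s²≤O² s²≡1
            Q≡0 : Q ≡ 0ℚ
            Q≡0 rewrite O≡1 | s²≡1 = trans (+-identityʳ _) (*-zeroˡ (1ℚ + R))

  -- Paths

  label : ∀ {n} → Permutation′ n → Fin n → ℕ
  label σ x = toℕ (σ ⟨$⟩ʳ x)

  IsPathLabelling : ∀ {n} → Adj n → Permutation′ n → Set
  IsPathLabelling A σ = ∀ a b → (A a b ≡ true) ⇔ (label σ a ≡ suc (label σ b) ⊎ label σ b ≡ suc (label σ a))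

  module PathLabelling {n} {A : Adj n} (σ : Permutation′ n) (path : IsPathLabelling A σ) where

    height : Fin n → ℚ
    height x = ℕtoℚ (label σ x)

    label-injective : ∀ {x y} → label σ x ≡ label σ y → x ≡ y
    label-injective {x} {y} e = trans (sym (inverseˡ σ)) (trans (cong (σ ⟨$⟩ˡ_) (Fin.toℕ-injective e)) (inverseˡ σ))

    vertex : ∀ k → k ℕ.< n → Fin n
    vertex k k<n = σ ⟨$⟩ˡ Fin.fromℕ< k<n

    label-vertex : ∀ k (k<n : k ℕ.< n) → label σ (vertex k k<n) ≡ k
    label-vertex k k<n = trans (cong toℕ (inverseʳ σ)) (Fin.toℕ-fromℕ< k<n)

    slope : Fin n → Fin n → ℚ
    slope c x = bℚ (A c x) * (height c - height x)

    slope-down : ∀ {c x} → label σ c ≡ suc (label σ x) → slope c x ≡ 1ℚ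
    slope-down {c} {x} e = trans (cong (λ b → bℚ b * (height c - height x)) (Equivalence.from (path c x) (inj₁ e)))
      (trans (*-identityˡ _) (trans (cong (λ k → ℕtoℚ k - height x) e) (ℕtoℚ-suc-drop (label σ x))))

    slope-up : ∀ {c x} → label σ x ≡ suc (label σ c) → slope c x ≡ - 1ℚ
    slope-up {c} {x} e = trans (cong (λ b → bℚ b * (height c - height x)) (Equivalence.from (path c x) (inj₂ e)))
      (trans (*-identityˡ _) (trans (solve 2 (λ a b → a :- b := :- (b :- a)) refl (height c) (height x))
        (cong -_ (trans (cong (λ k → ℕtoℚ k - height c) e) (ℕtoℚ-suc-drop (label σ c))))))

    slope-far : ∀ {c x} → label σ c ≢ suc (label σ x) → label σ x ≢ suc (label σ c) → slope c x ≡ 0ℚ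
    slope-far {c} {x} ≢down ≢up with A c x in Acx
    ... | false = *-zeroˡ (height c - height x)
    ... | true with Equivalence.to (path c x) Acx
    ...   | inj₁ down = ⊥-elim (≢down down)
    ...   | inj₂ up = ⊥-elim (≢up up)

    slope-edge : ∀ {a b} → A a b ≡ true → slope a b ≡ height a - height b
    slope-edge {a} {b} Aab = trans (cong (λ e → bℚ e * (height a - height b)) Aab) (*-identityˡ (height a - height b))

    height-drop±1 : ∀ {a b} → A a b ≡ true → height a - height b ≡ 1ℚ ⊎ height a - height b ≡ - 1ℚ
    height-drop±1 {a} {b} Aab with Equivalence.to (path a b) Aab
    ... | inj₁ down = inj₁ (trans (sym (slope-edge Aab)) (slope-down down))
    ... | inj₂ up = inj₂ (trans (sym (slope-edge Aab)) (slope-up up))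

    module _ {c k} (c≡k : label σ c ≡ k) where

      slope-to-below : ∀ {k′} (k′<n : k′ ℕ.< n) → k ≡ suc k′ → slope c (vertex k′ k′<n) ≡ 1ℚ
      slope-to-below {k′} k′<n k≡sk′ =
        slope-down (trans c≡k (trans k≡sk′ (cong suc (sym (label-vertex k′ k′<n)))))

      slope-to-above : (sk<n : suc k ℕ.< n) → slope c (vertex (suc k) sk<n) ≡ - 1ℚ
      slope-to-above sk<n = slope-up (trans (label-vertex (suc k) sk<n) (cong suc (sym c≡k)))

      not-below : ∀ {k′ x} (k′<n : k′ ℕ.< n) → k ≡ suc k′ → vertex k′ k′<n ≢ x →
                  label σ c ≢ suc (label σ x)
      not-below {k′} k′<n k≡sk′ v≢x e =
        v≢x (label-injective (trans (label-vertex k′ k′<n) (ℕ.suc-injective (trans (sym k≡sk′) (trans (sym c≡k) e)))))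

      not-above : ∀ {x} (sk<n : suc k ℕ.< n) → vertex (suc k) sk<n ≢ x → label σ x ≢ suc (label σ c)
      not-above sk<n v≢x e = v≢x (label-injective (trans (label-vertex (suc k) sk<n) (sym (trans e (cong suc c≡k)))))

    module _ {T B : Fin n} (T-top : label σ T ≡ n ∸ 1) (B-bottom : label σ B ≡ 0) (T≢B : T ≢ B) where

      private
        below-top : ∀ {m k} → m ∸ 1 ≡ k → suc k ℕ.< m → ⊥
        below-top {suc m} refl m<m = ℕ.<-irrefl refl (ℕ.≤-pred m<m)

        1<n : 1 ℕ.< n
        1<n = 1<m (λ n∸1≡0 → T≢B (label-injective (trans T-top (trans n∸1≡0 (sym B-bottom)))))
          where 1<m : ∀ {m} → m ∸ 1 ≢ 0 → 1 ℕ.< m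
                1<m {zero} m∸1≢0 = ⊥-elim (m∸1≢0 refl)
                1<m {suc zero} m∸1≢0 = ⊥-elim (m∸1≢0 refl)
                1<m {suc (suc m)} _ = ℕ.s≤s (ℕ.s≤s ℕ.z≤n)

        label<n : ∀ x → label σ x ℕ.< n
        label<n x = Fin.toℕ<n (σ ⟨$⟩ʳ x)

        B≢above : ∀ {c k} → label σ c ≡ suc k → B ≢ c
        B≢above c≡sk B≡c = ℕ.0≢1+n (trans (sym B-bottom) (trans (cong (label σ) B≡c) c≡sk))

        lap-bottom : ∀ c → label σ c ≡ 0 → lap A height c ≡ δ T c - δ B c
        lap-bottom c c≡0 = begin
          lap A height c
            ≡⟨ sumℚ-support₁ (slope c) up
                 (λ x up≢x → slope-far (λ e → ℕ.0≢1+n (trans (sym c≡0) e)) (not-above c≡0 1<n up≢x)) ⟩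
          slope c up                       ≡⟨ slope-to-above c≡0 1<n ⟩
          0ℚ - 1ℚ
            ≡⟨ cong₂ _-_ (δ-≢ (λ T≡c → T≢B (trans T≡c c≡B))) (trans (cong (δ B) c≡B) (δ-refl B)) ⟨
          δ T c - δ B c                    ∎
          where
            open ≡-Reasoning
            up : Fin n
            up = vertex 1 1<n
            c≡B : c ≡ B
            c≡B = label-injective (trans c≡0 (sym B-bottom))

        lap-inner : ∀ c k → label σ c ≡ suc k → suc (suc k) ℕ.< n → lap A height c ≡ δ T c - δ B c
        lap-inner c k c≡sk ssk<n = begin
          lap A height c
            ≡⟨ sumℚ-support₂ (slope c) dn≢up
                 (λ x dn≢x up≢x → slope-far (not-below c≡sk k<n refl dn≢x) (not-above c≡sk ssk<n up≢x)) ⟩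
          slope c dn + slope c up          ≡⟨ cong₂ _+_ (slope-to-below c≡sk k<n refl) (slope-to-above c≡sk ssk<n) ⟩
          1ℚ + - 1ℚ                        ≡⟨ cong₂ _-_ (δ-≢ T≢c) (δ-≢ (B≢above c≡sk)) ⟨
          δ T c - δ B c                    ∎
          where
            open ≡-Reasoning
            k<n : k ℕ.< n
            k<n = ℕ.<-trans (ℕ.n<1+n k) (ℕ.<-trans (ℕ.n<1+n (suc k)) ssk<n)
            dn up : Fin n
            dn = vertex k k<n
            up = vertex (suc (suc k)) ssk<n
            dn≢up : dn ≢ up
            dn≢up e = ℕ.<⇒≢ (ℕ.<-trans (ℕ.n<1+n k) (ℕ.n<1+n (suc k)))
              (trans (sym (label-vertex k k<n)) (trans (cong (label σ) e) (label-vertex (suc (suc k)) ssk<n)))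
            T≢c : T ≢ c
            T≢c T≡c = below-top (trans (sym T-top) (trans (cong (label σ) T≡c) c≡sk)) ssk<n

        lap-top : ∀ c k → label σ c ≡ suc k → ¬ suc (suc k) ℕ.< n → lap A height c ≡ δ T c - δ B c
        lap-top c k c≡sk ssk≮n = begin
          lap A height c
            ≡⟨ sumℚ-support₁ (slope c) dn (λ x dn≢x → slope-far (not-below c≡sk k<n refl dn≢x) (top x)) ⟩
          slope c dn                       ≡⟨ slope-to-below c≡sk k<n refl ⟩
          1ℚ - 0ℚ
            ≡⟨ cong₂ _-_ (trans (cong (δ T) c≡T) (δ-refl T)) (δ-≢ (B≢above c≡sk)) ⟨
          δ T c - δ B c                    ∎
          where
            open ≡-Reasoning
            sk<n : suc k ℕ.< n
            sk<n = subst (ℕ._< n) c≡sk (label<n c)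
            k<n : k ℕ.< n
            k<n = ℕ.<-trans (ℕ.n<1+n k) sk<n
            dn : Fin n
            dn = vertex k k<n
            top : ∀ x → label σ x ≢ suc (label σ c)
            top x e = ssk≮n (subst (ℕ._< n) (trans e (cong suc c≡sk)) (label<n x))
            c≡T : c ≡ T
            c≡T = label-injective
              (trans c≡sk (trans (cong (ℕ._∸ 1) (ℕ.≤-antisym sk<n (ℕ.≮⇒≥ ssk≮n))) (sym T-top)))

      height-potential : IsPotential A T B height
      height-potential = kirchhoff λ c → lap-at c (label σ c) refl
        where
          lap-at : ∀ c k → label σ c ≡ k → lap A height c ≡ δ T c - δ B c
          lap-at c zero c≡0 = lap-bottom c c≡0
          lap-at c (suc k) c≡sk with suc (suc k) ℕ.<? n
          ... | yes ssk<n = lap-inner c k c≡sk ssk<n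
          ... | no ssk≮n = lap-top c k c≡sk ssk≮n

  -- The cyclicity index of G + ij

  module EdgeAddition {n} {A : Adj n} (symA : ∀ a b → A a b ≡ A b a) (loopless : ∀ a → A a a ≡ false)
    (conn : Connected A) {i j : Fin n} (i≢j : i ≢ j) (Aij≡false : A i j ≡ false)
    {Ω Ω⁺ : Fin n → Fin n → ℚ} (res : IsResistance A Ω) (res⁺ : IsResistance (addEdge A i j) Ω⁺) where

    A⁺ : Adj n
    A⁺ = addEdge A i j

    Aji≡false : A j i ≡ false
    Aji≡false = trans (symA j i) Aij≡false

    conn⁺ : Connected A⁺
    conn⁺ = addEdge-connected A i j conn

    u : Fin n → ℚ
    u = proj₁ (res i j)

    u-pot : IsPotential A i j u
    u-pot = effRes-potential A (res i j)

    R : ℚ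
    R = Ω i j

    R≡ : R ≡ u i - u j
    R≡ = proj₂ (proj₂ (res i j))

    0<R : 0ℚ < R
    0<R = effRes-pos conn res i≢j

    D : ℚ
    D = 1ℚ + R

    0<D : 0ℚ < D
    0<D = subst (_< D) (+-identityʳ 0ℚ) (+-mono-<-≤ 0<1 (<⇒≤ 0<R))

    flow : Fin n → Fin n → ℚ
    flow a b = u a - u b

    flow²≤Ω² : ∀ a b → flow a b * flow a b ≤ Ω a b * Ω a b
    flow²≤Ω² a b = subst₂ (λ p q → p * p ≤ q * q)
      (reciprocity A symA (effRes-potential A (res a b)) u-pot) (sym (proj₂ (proj₂ (res a b))))
      (potential-diff²≤drop² conn (effRes-potential A (res a b)) i j)

    -- Sherman–Morrison: correcting by a multiple of u turns a potential of G into one of G + ij.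
    shifted-potential : ∀ {a b v} → IsPotential A a b v → ∀ t → t * D ≡ v i - v j →
                        IsPotential A⁺ a b (λ x → v x - t * u x)
    shifted-potential {a} {b} {v} v-pot t tD≡ = kirchhoff λ c → begin
      lap A⁺ w c
        ≡⟨ lap-addEdge A i j i≢j Aij≡false Aji≡false w c ⟩
      lap A w c + (δ i c - δ j c) * (w i - w j)
        ≡⟨ cong₂ (λ p q → p + (δ i c - δ j c) * q) (lapw c) wi-wj≡ ⟩
      (δ a c - δ b c) - t * (δ i c - δ j c) + (δ i c - δ j c) * ((v i - v j) - t * R)
        ≡⟨ solve 5 (λ X P t f R → X :- t :* P :+ P :* (f :- t :* R) := X :+ P :* (f :- t :* (con 1ℚ :+ R)))
             refl (δ a c - δ b c) (δ i c - δ j c) t (v i - v j) R ⟩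
      (δ a c - δ b c) + (δ i c - δ j c) * ((v i - v j) - t * D)
        ≡⟨ cong (λ q → (δ a c - δ b c) + (δ i c - δ j c) * ((v i - v j) - q)) tD≡ ⟩
      (δ a c - δ b c) + (δ i c - δ j c) * ((v i - v j) - (v i - v j))
        ≡⟨ solve 3 (λ X P f → X :+ P :* (f :- f) := X) refl (δ a c - δ b c) (δ i c - δ j c) (v i - v j) ⟩
      δ a c - δ b c                                                   ∎
      where
        open ≡-Reasoning
        w : Fin n → ℚ
        w x = v x - t * u x
        wi-wj≡ : w i - w j ≡ (v i - v j) - t * R
        wi-wj≡ = trans (solve 5 (λ vi vj t ui uj → (vi :- t :* ui) :- (vj :- t :* uj) := (vi :- vj) :- t :* (ui :- uj))
                          refl (v i) (v j) t (u i) (u j))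
                       (cong (λ q → (v i - v j) - t * q) (sym R≡))
        lapw : ∀ c → lap A w c ≡ (δ a c - δ b c) - t * (δ i c - δ j c)
        lapw c = trans (lap-- A v (λ x → t * u x) c)
          (cong₂ _-_ (lap≡ v-pot c) (trans (lap-*ˡ A t u c) (cong (t *_) (lap≡ u-pot c))))

    effRes-addEdge : ∀ a b → D * Ω⁺ a b ≡ D * Ω a b - flow a b * flow a b
    effRes-addEdge a b = begin
      D * Ω⁺ a b                                   ≡⟨ cong (D *_) Ω⁺≡ ⟩
      D * ((v a - t * u a) - (v b - t * u b))
        ≡⟨ solve 6 (λ D va vb t ua ub → D :* ((va :- t :* ua) :- (vb :- t :* ub)) := D :* (va :- vb) :- (t :* D) :* (ua :- ub))
             refl D (v a) (v b) t (u a) (u b) ⟩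
      D * (v a - v b) - (t * D) * flow a b         ≡⟨ cong₂ (λ p q → D * p - q * flow a b) (sym Ωab≡) tD≡flow ⟩
      D * Ω a b - flow a b * flow a b              ∎
      where
        open ≡-Reasoning
        v : Fin n → ℚ
        v = proj₁ (res a b)
        v-pot : IsPotential A a b v
        v-pot = effRes-potential A (res a b)
        Ωab≡ : Ω a b ≡ v a - v b
        Ωab≡ = proj₂ (proj₂ (res a b))
        t : ℚ
        t = flow a b * inv D
        tD≡flow : t * D ≡ flow a b
        tD≡flow = trans (*-assoc (flow a b) (inv D) D) (trans (cong (flow a b *_) (inv-inverseˡ 0<D)) (*-identityʳ (flow a b)))
        w-pot : IsPotential A⁺ a b (λ x → v x - t * u x)
        w-pot = shifted-potential v-pot t (trans tD≡flow (sym (reciprocity A symA v-pot u-pot)))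
        Ω⁺≡ : Ω⁺ a b ≡ (v a - t * u a) - (v b - t * u b)
        Ω⁺≡ = trans (proj₂ (proj₂ (res⁺ a b)))
          (lap-injective-mod-constant conn⁺ (proj₁ (res⁺ a b)) (λ x → v x - t * u x)
          (λ c → trans (lap≡ (effRes-potential A⁺ (res⁺ a b)) c) (sym (lap≡ w-pot c))) a b)

    increment : Fin n → Fin n → ℚ
    increment a b = inv (Ω⁺ a b) - inv (Ω a b)

    module AtEdge {a b} (Aab : A a b ≡ true) = ReciprocalIncrement (Ω a b) (Ω⁺ a b) (flow a b) R
      (effRes-pos conn res (edge⇒≢ conn loopless Aab)) (effRes-edge≤1 conn loopless res Aab) (flow²≤Ω² a b)
      0<R (effRes-pos conn⁺ res⁺ (edge⇒≢ conn loopless Aab)) (effRes-addEdge a b)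

    new-edge-term : inv (Ω⁺ i j) - 1ℚ ≡ inv R
    new-edge-term = p-q≡0⇒p≡q (*≡0⇒≡0 (*-pos 0<O⁺ 0<R) (begin
      (X - 1ℚ - Z) * (O⁺ * R)
        ≡⟨ solve 4 (λ X Z O⁺ R → (X :- con 1ℚ :- Z) :* (O⁺ :* R)
                                  := (X :* O⁺) :* R :- (Z :* R) :* O⁺ :- (con 1ℚ :+ R) :* O⁺ :+ O⁺)
             refl X Z O⁺ R ⟩
      (X * O⁺) * R - (Z * R) * O⁺ - D * O⁺ + O⁺
        ≡⟨ cong₂ (λ p q → p * R - q * O⁺ - D * O⁺ + O⁺) (inv-inverseˡ 0<O⁺) (inv-inverseˡ 0<R) ⟩
      1ℚ * R - 1ℚ * O⁺ - D * O⁺ + O⁺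
        ≡⟨ cong (λ t → 1ℚ * R - 1ℚ * O⁺ - t + O⁺) DO⁺≡R ⟩
      1ℚ * R - 1ℚ * O⁺ - R + O⁺
        ≡⟨ solve 2 (λ R O⁺ → con 1ℚ :* R :- con 1ℚ :* O⁺ :- R :+ O⁺ := con 0ℚ) refl R O⁺ ⟩
      0ℚ                                       ∎))
      where
        open ≡-Reasoning
        O⁺ X Z : ℚ
        O⁺ = Ω⁺ i j
        X = inv O⁺
        Z = inv R
        0<O⁺ : 0ℚ < O⁺
        0<O⁺ = effRes-pos conn⁺ res⁺ i≢j
        -- the flow across the new edge is the whole potential drop R
        DO⁺≡R : D * O⁺ ≡ R
        DO⁺≡R = trans (effRes-addEdge i j) (trans (cong (λ f → D * R - f * f) (sym R≡))
                  (solve 1 (λ R → (con 1ℚ :+ R) :* R :- R :* R := R) refl R))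

    Δcyc≡ : cyc A⁺ Ω⁺ - cyc A Ω ≡ inv R + edgeSumℚ A increment
    Δcyc≡ = begin
      edgeSumℚ A⁺ F⁺ - edgeSumℚ A F
        ≡⟨ cong (_- edgeSumℚ A F) (edgeSumℚ-addEdge A i≢j Aij≡false Aji≡false F⁺ F⁺-sym) ⟩
      edgeSumℚ A F⁺ + F⁺ i j - edgeSumℚ A F
        ≡⟨ solve 3 (λ E⁺ f E → E⁺ :+ f :- E := f :+ (E⁺ :- E)) refl (edgeSumℚ A F⁺) (F⁺ i j) (edgeSumℚ A F) ⟩
      F⁺ i j + (edgeSumℚ A F⁺ - edgeSumℚ A F)        ≡⟨ cong₂ _+_ new-edge-term (sym (edgeSumℚ-- A F⁺ F)) ⟩
      inv R + edgeSumℚ A (λ a b → F⁺ a b - F a b)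
        ≡⟨ cong (inv R +_) (edgeSumℚ-cong A (λ a b _ → F⁺-F≡increment a b)) ⟩
      inv R + edgeSumℚ A increment                   ∎
      where
        open ≡-Reasoning
        F⁺ F : Fin n → Fin n → ℚ
        F⁺ a b = inv (Ω⁺ a b) - 1ℚ
        F a b = inv (Ω a b) - 1ℚ
        F⁺-sym : F⁺ j i ≡ F⁺ i j
        F⁺-sym = cong (λ r → inv r - 1ℚ) (effRes-sym conn⁺ res⁺ i j)
        F⁺-F≡increment : ∀ a b → F⁺ a b - F a b ≡ increment a b
        F⁺-F≡increment a b =
          solve 2 (λ x y → (x :- con 1ℚ) :- (y :- con 1ℚ) := x :- y) refl (inv (Ω⁺ a b)) (inv (Ω a b))

    increment-nonNeg : ∀ a b → A a b ≡ true → 0ℚ ≤ increment a b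
    increment-nonNeg a b Aab = AtEdge.increment-nonNeg Aab

    ui≢uj : u i ≢ u j
    ui≢uj ui≡uj = <-irrefl (sym (trans R≡ (trans (cong (_- u j) ui≡uj) (+-inverseʳ (u j))))) 0<R

    flow≢0 : ∀ {a b} → u a ≢ u b → flow a b ≢ 0ℚ
    flow≢0 ua≢ub flow≡0 = ua≢ub (p-q≡0⇒p≡q flow≡0)

    edgeSum-increment-pos : 0ℚ < edgeSumℚ A increment
    edgeSum-increment-pos with nonconstant-edge u (conn i j) ui≢uj
    ... | c , d , Acd , uc≢ud with <ᵇ-total (edge⇒≢ conn loopless Acd)
    ... | inj₁ c<d = edgeSumℚ-pos A increment-nonNeg c<d Acd (AtEdge.increment-pos Acd (flow≢0 uc≢ud))
    ... | inj₂ d<c =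
      edgeSumℚ-pos A increment-nonNeg d<c Adc (AtEdge.increment-pos Adc (flow≢0 (λ ud≡uc → uc≢ud (sym ud≡uc))))
      where Adc : A d c ≡ true
            Adc = trans (symA d c) Acd

    Δcyc-lower : inv R < cyc A⁺ Ω⁺ - cyc A Ω
    Δcyc-lower = subst (inv R <_) (sym Δcyc≡)
      (subst (_< inv R + edgeSumℚ A increment) (+-identityʳ (inv R)) (+-monoʳ-< (inv R) edgeSum-increment-pos))

    bound≡ : ℕtoℚ (numEdges A ℕ.+ 1) * inv R ≡ inv R + edgeSumℚ A (λ _ _ → inv R)
    bound≡ = begin
      ℕtoℚ (numEdges A ℕ.+ 1) * inv R           ≡⟨ cong (_* inv R) (ℕtoℚ-+ (numEdges A) 1) ⟩
      (ℕtoℚ (numEdges A) + 1ℚ) * inv R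
        ≡⟨ solve 2 (λ m z → (m :+ con 1ℚ) :* z := z :+ m :* z) refl (ℕtoℚ (numEdges A)) (inv R) ⟩
      inv R + ℕtoℚ (numEdges A) * inv R         ≡⟨ cong (inv R +_) (edgeSumℚ-const A (inv R)) ⟨
      inv R + edgeSumℚ A (λ _ _ → inv R)        ∎
      where open ≡-Reasoning

    Δcyc-upper : cyc A⁺ Ω⁺ - cyc A Ω ≤ ℕtoℚ (numEdges A ℕ.+ 1) * inv R
    Δcyc-upper = subst₂ _≤_ (sym Δcyc≡) (sym bound≡)
      (+-monoʳ-≤ (inv R) (edgeSumℚ-mono-≤ A (λ a b Aab → AtEdge.increment≤inv Aab)))

    UnitFlow : Set
    UnitFlow = ∀ a b → A a b ≡ true → flow a b * flow a b ≡ 1ℚ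

    Δcyc≡bound⇔unitFlow : (cyc A⁺ Ω⁺ - cyc A Ω ≡ ℕtoℚ (numEdges A ℕ.+ 1) * inv R) ⇔ UnitFlow
    Δcyc≡bound⇔unitFlow = mk⇔ to from
      where
        slack : Fin n → Fin n → ℚ
        slack a b = inv R - increment a b
        slack-nonNeg : ∀ a b → A a b ≡ true → 0ℚ ≤ slack a b
        slack-nonNeg a b Aab = p≤q⇒0≤q-p (AtEdge.increment≤inv Aab)
        to : cyc A⁺ Ω⁺ - cyc A Ω ≡ ℕtoℚ (numEdges A ℕ.+ 1) * inv R → UnitFlow
        to tight = unit
          where
            Σbound≡Σincrement : edgeSumℚ A (λ _ _ → inv R) ≡ edgeSumℚ A increment
            Σbound≡Σincrement = +-cancelˡ-≡ (inv R) _ _ (trans (sym bound≡) (trans (sym tight) Δcyc≡))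
            Σslack≡0 : edgeSumℚ A slack ≡ 0ℚ
            Σslack≡0 = trans (edgeSumℚ-- A (λ _ _ → inv R) increment)
              (trans (cong (_- edgeSumℚ A increment) Σbound≡Σincrement) (+-inverseʳ (edgeSumℚ A increment)))
            oriented : ∀ {a b} → a <ᵇ b ≡ true → (Aab : A a b ≡ true) → flow a b * flow a b ≡ 1ℚ
            oriented a<b Aab = Equivalence.to (AtEdge.increment≡inv⇔s²≡1 Aab)
              (sym (p-q≡0⇒p≡q (edgeSumℚ≤0⇒≡0 A slack-nonNeg (≤-reflexive Σslack≡0) a<b Aab)))
            unit : UnitFlow
            unit a b Aab with <ᵇ-total (edge⇒≢ conn loopless Aab)
            ... | inj₁ a<b = oriented a<b Aab
            ... | inj₂ b<a = trans (solve 2 (λ x y → (x :- y) :* (x :- y) := (y :- x) :* (y :- x)) refl (u a) (u b))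
                                   (oriented b<a (trans (symA b a) Aab))
        from : UnitFlow → cyc A⁺ Ω⁺ - cyc A Ω ≡ ℕtoℚ (numEdges A ℕ.+ 1) * inv R
        from unit = trans Δcyc≡ (trans (cong (inv R +_) (edgeSumℚ-cong A tight-edge)) (sym bound≡))
          where tight-edge : ∀ a b → A a b ≡ true → increment a b ≡ inv R
                tight-edge a b Aab = Equivalence.from (AtEdge.increment≡inv⇔s²≡1 Aab) (unit a b Aab)

  -- The equality case

  module EqualityCase {n} {A : Adj n} (symA : ∀ a b → A a b ≡ A b a) (loopless : ∀ a → A a a ≡ false)
    (conn : Connected A) {i j : Fin n} (i≢j : i ≢ j) (Aij≡false : A i j ≡ false)
    {Ω Ω⁺ : Fin n → Fin n → ℚ} (res : IsResistance A Ω) (res⁺ : IsResistance (addEdge A i j) Ω⁺) where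

    open EdgeAddition symA loopless conn i≢j Aij≡false res res⁺

    unitFlow-from-potential : ∀ {w} → IsPotential A i j w →
                              (∀ a b → A a b ≡ true → (w a - w b) * (w a - w b) ≡ 1ℚ) → UnitFlow
    unitFlow-from-potential {w} w-pot unit a b Aab = trans
      (cong (λ t → t * t) (lap-injective-mod-constant conn u w (λ c → trans (lap≡ u-pot c) (sym (lap≡ w-pot c))) a b))
      (unit a b Aab)

    path⇒unitFlow : IsPathWithEnds A i j → UnitFlow
    path⇒unitFlow (σ , path , inj₂ (j-bottom , i-top)) =
      unitFlow-from-potential (height-potential i-top j-bottom i≢j) (λ a b Aab → ±1⇒square≡1 (height-drop±1 Aab))
      where open PathLabelling σ path
    path⇒unitFlow (σ , path , inj₁ (i-bottom , j-top)) =
      unitFlow-from-potential (potential-neg (height-potential j-top i-bottom (λ j≡i → i≢j (sym j≡i))))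
        (λ a b Aab → trans (neg-drop² (height a) (height b)) (±1⇒square≡1 (height-drop±1 Aab)))
      where
        open PathLabelling σ path
        neg-drop² : ∀ x y → ((- x) - (- y)) * ((- x) - (- y)) ≡ (x - y) * (x - y)
        neg-drop² = solve 2 (λ x y → ((:- x) :- (:- y)) :* ((:- x) :- (:- y)) := (x :- y) :* (x :- y)) refl

    module _ (unit : UnitFlow) where

      flow±1 : ∀ {a b} → A a b ≡ true → flow a b ≡ 1ℚ ⊎ flow a b ≡ - 1ℚ
      flow±1 {a} {b} Aab = square≡1⇒±1 (flow a b) (unit a b Aab)

      Descends : Fin n → Fin n → Set
      Descends c y = A c y ≡ true × u y ≡ u c - 1ℚ

      flow≡1⇒descends : ∀ {c y} → A c y ≡ true → flow c y ≡ 1ℚ → Descends c y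
      flow≡1⇒descends {c} {y} Acy flow≡1 =
        Acy , trans (solve 2 (λ a b → b := a :- (a :- b)) refl (u c) (u y)) (cong (λ t → u c - t) flow≡1)

      -- Away from j the unit flow leaves c, so some edge at c carries it downhill.
      descent : ∀ c → c ≢ j → Σ (Fin n) (Descends c)
      descent c c≢j with Fin.any? (λ y → (A c y Bool.≟ true) ×-dec (u y ≟ (u c - 1ℚ)))
      ... | yes found = found
      ... | no none = ⊥-elim (no-first-step (conn c j))
        where
          τ : Fin n → ℚ
          τ y = - (bℚ (A c y) * (u c - u y))
          τ-uphill : ∀ {y} → A c y ≡ true → flow c y ≡ - 1ℚ → τ y ≡ 1ℚ
          τ-uphill {y} Acy flow≡-1 =
            cong -_ (trans (cong (λ e → bℚ e * (u c - u y)) Acy) (trans (*-identityˡ (u c - u y)) flow≡-1))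
          τ-nonNeg : ∀ y → 0ℚ ≤ τ y
          τ-nonNeg y with A c y in Acy
          ... | false = ≤-reflexive (sym (cong -_ (*-zeroˡ (u c - u y))))
          ... | true with flow±1 Acy
          ...   | inj₁ flow≡1 = ⊥-elim (none (y , flow≡1⇒descends Acy flow≡1))
          ...   | inj₂ flow≡-1 = subst (0ℚ ≤_) (sym (cong -_ (trans (*-identityˡ (u c - u y)) flow≡-1))) (<⇒≤ 0<1)
          0≤lap : 0ℚ ≤ lap A u c
          0≤lap = subst (0ℚ ≤_) (sym (trans (lap≡ u-pot c)
            (trans (cong (λ t → δ i c - t) (δ-≢ (λ j≡c → c≢j (sym j≡c)))) (+-identityʳ (δ i c))))) (δ-nonNeg i c)
          Στ≤0 : sumℚ n τ ≤ 0ℚ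
          Στ≤0 = subst (_≤ 0ℚ) (sym (sumℚ-neg n _)) (neg-antimono-≤ 0≤lap)
          no-first-step : Reach A c j → ⊥
          no-first-step here = c≢j refl
          no-first-step (step {b = b} Acb _) with flow±1 Acb
          ... | inj₁ flow≡1 = none (b , flow≡1⇒descends Acb flow≡1)
          ... | inj₂ flow≡-1 =
            <-irrefl (sym (sumℚ≤0⇒≡0 τ τ-nonNeg Στ≤0 b)) (subst (0ℚ <_) (sym (τ-uphill Acb flow≡-1)) 0<1)

      next : Fin n → Fin n
      next c with c Fin.≟ j
      ... | yes _ = j
      ... | no c≢j = proj₁ (descent c c≢j)

      next-descends : ∀ c → c ≢ j → Descends c (next c)
      next-descends c c≢j with c Fin.≟ j
      ... | yes c≡j = ⊥-elim (c≢j c≡j)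
      ... | no c≢j′ = proj₂ (descent c c≢j′)

      walk : ℕ → Fin n
      walk zero = i
      walk (suc t) = next (walk t)

      MissesJ : ℕ → Set
      MissesJ t = ∀ s → s ℕ.< t → walk s ≢ j

      missesJ-≤ : ∀ {s t} → s ℕ.≤ t → MissesJ t → MissesJ s
      missesJ-≤ s≤t misses r r<s = misses r (ℕ.<-≤-trans r<s s≤t)

      u-walk : ∀ t → MissesJ t → u (walk t) ≡ u i - ℕtoℚ t
      u-walk zero _ = solve 1 (λ x → x := x :- con 0ℚ) refl (u i)
      u-walk (suc t) misses = begin
        u (walk (suc t))          ≡⟨ proj₂ (next-descends (walk t) (misses t (ℕ.n<1+n t))) ⟩
        u (walk t) - 1ℚ           ≡⟨ cong (_- 1ℚ) (u-walk t (missesJ-≤ (ℕ.n≤1+n t) misses)) ⟩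
        u i - ℕtoℚ t - 1ℚ
          ≡⟨ solve 2 (λ a b → a :- b :- con 1ℚ := a :- (con 1ℚ :+ b)) refl (u i) (ℕtoℚ t) ⟩
        u i - (1ℚ + ℕtoℚ t)       ≡⟨ cong (λ x → u i - x) (ℕtoℚ-suc t) ⟨
        u i - ℕtoℚ (suc t)        ∎
        where open ≡-Reasoning

      walk-injective : ∀ {N s t} → MissesJ N → s ℕ.≤ N → t ℕ.≤ N → walk s ≡ walk t → s ≡ t
      walk-injective {N} {s} {t} misses s≤N t≤N ws≡wt = ℕtoℚ-injective (neg-injective (+-cancelˡ-≡ (u i) _ _
        (trans (sym (u-walk s (missesJ-≤ s≤N misses))) (trans (cong u ws≡wt) (u-walk t (missesJ-≤ t≤N misses))))))

      missesJ⇒<n : ∀ {N} → MissesJ N → N ℕ.< n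
      missesJ⇒<n {N} misses = Fin.injective⇒≤ {f = λ (k : Fin (suc N)) → walk (toℕ k)}
        (λ {x} {y} e → Fin.toℕ-injective
          (walk-injective misses (ℕ.≤-pred (Fin.toℕ<n x)) (ℕ.≤-pred (Fin.toℕ<n y)) e))

      HitsJ : ℕ → Set
      HitsJ T = walk T ≡ j × MissesJ T

      search-j : ∀ N → (Σ ℕ HitsJ) ⊎ MissesJ (suc N)
      search-j zero with walk zero Fin.≟ j
      ... | yes w0≡j = inj₁ (0 , w0≡j , λ _ ())
      ... | no w0≢j = inj₂ λ { zero _ → w0≢j ; (suc _) (ℕ.s≤s ()) }
      search-j (suc N) with search-j N
      ... | inj₁ found = inj₁ found
      ... | inj₂ misses with walk (suc N) Fin.≟ j
      ...   | yes wN≡j = inj₁ (suc N , wN≡j , misses)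
      ...   | no wN≢j = inj₂ λ s s<ssN → case ℕ.m≤n⇒m<n∨m≡n (ℕ.≤-pred s<ssN) of λ
                { (inj₁ s<sN) → misses s s<sN ; (inj₂ refl) → wN≢j }

      reaches-j : Σ ℕ HitsJ
      reaches-j with search-j n
      ... | inj₁ found = found
      ... | inj₂ misses = ⊥-elim (ℕ.<-irrefl refl (ℕ.<-trans (ℕ.n<1+n n) (missesJ⇒<n misses)))

      T : ℕ
      T = proj₁ reaches-j

      walk-T : walk T ≡ j
      walk-T = proj₁ (proj₂ reaches-j)

      misses-T : MissesJ T
      misses-T = proj₂ (proj₂ reaches-j)

      T<n : T ℕ.< n
      T<n = missesJ⇒<n misses-T

      walk-edge : ∀ s → s ℕ.< T → A (walk s) (walk (suc s)) ≡ true
      walk-edge s s<T = proj₁ (next-descends (walk s) (misses-T s s<T))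

      OnWalk : Fin n → Set
      OnWalk x = Σ ℕ λ s → s ℕ.≤ T × walk s ≡ x

      onWalk? : ∀ x → Dec (OnWalk x)
      onWalk? x with Fin.any? {n = suc T} (λ k → walk (toℕ k) Fin.≟ x)
      ... | yes (k , wk≡x) = yes (toℕ k , ℕ.≤-pred (Fin.toℕ<n k) , wk≡x)
      ... | no none = no λ { (s , s≤T , ws≡x) →
        none (Fin.fromℕ< (ℕ.s≤s s≤T) , trans (cong walk (Fin.toℕ-fromℕ< (ℕ.s≤s s≤T))) ws≡x) }

      -- The edge zy has unit resistance, so its own unit flow is constant along the walk from i to j (which
      -- avoids z), and by reciprocity the i→j flow through zy would vanish.
      off-walk-isolated : ∀ {z y} → ¬ OnWalk z → A z y ≡ true → ⊥
      off-walk-isolated {z} {y} off-z Azy = <-irrefl (sym flow²≡0) (subst (0ℚ <_) (sym (unit z y Azy)) 0<1)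
        where
          v : Fin n → ℚ
          v = proj₁ (res z y)
          v-pot : IsPotential A z y v
          v-pot = effRes-potential A (res z y)
          drop≡1 : v z - v y ≡ 1ℚ
          drop≡1 = trans (sym (proj₂ (proj₂ (res z y))))
            (s²≤O²≤1-tight (flow z y) (effRes-pos conn res (edge⇒≢ conn loopless Azy))
              (effRes-edge≤1 conn loopless res Azy) (flow²≤Ω² z y) (unit z y Azy))
          flat : ∀ s → s ℕ.≤ T → v (walk s) ≡ v i
          flat zero _ = refl
          flat (suc s) ss≤T = trans
            (sym (unit-edge-isolated conn loopless symA Azy v-pot drop≡1 (walk s) (walk (suc s)) (walk-edge s ss≤T)
                   (λ z≡ws → off-z (s , s≤T , sym z≡ws)) (λ z≡wss → off-z (suc s , ss≤T , sym z≡wss))))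
            (flat s s≤T)
            where s≤T = ℕ.≤-trans (ℕ.n≤1+n s) ss≤T
          flow≡0 : flow z y ≡ 0ℚ
          flow≡0 = trans (sym (reciprocity A symA v-pot u-pot))
            (trans (cong (λ t → v i - t) (trans (cong v (sym walk-T)) (flat T ℕ.≤-refl))) (+-inverseʳ (v i)))
          flow²≡0 : flow z y * flow z y ≡ 0ℚ
          flow²≡0 = cong (λ t → t * t) flow≡0

      on-walk : ∀ x → OnWalk x
      on-walk x with onWalk? x | conn x i
      ... | yes on | _ = on
      ... | no off | here = ⊥-elim (off (0 , ℕ.z≤n , refl))
      ... | no off | step Axb _ = ⊥-elim (off-walk-isolated off Axb)

      position : Fin n → ℕ
      position x = proj₁ (on-walk x)

      position≤T : ∀ x → position x ℕ.≤ T
      position≤T x = proj₁ (proj₂ (on-walk x))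

      walk-position : ∀ x → walk (position x) ≡ x
      walk-position x = proj₂ (proj₂ (on-walk x))

      position-walk : ∀ s → s ℕ.≤ T → position (walk s) ≡ s
      position-walk s s≤T = walk-injective misses-T (position≤T (walk s)) s≤T (walk-position (walk s))

      position-injective : ∀ {x y} → position x ≡ position y → x ≡ y
      position-injective {x} {y} e = trans (sym (walk-position x)) (trans (cong walk e) (walk-position y))

      position<n : ∀ x → position x ℕ.< n
      position<n x = ℕ.≤-<-trans (position≤T x) T<n

      n≡1+T : n ≡ suc T
      n≡1+T = ℕ.≤-antisym (Fin.injective⇒≤ {f = λ x → Fin.fromℕ< (ℕ.s≤s (position≤T x))} injective) T<n
        where
          injective : ∀ {x y} → Fin.fromℕ< (ℕ.s≤s (position≤T x)) ≡ Fin.fromℕ< (ℕ.s≤s (position≤T y)) →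
                      x ≡ y
          injective {x} {y} e = position-injective (trans (sym (Fin.toℕ-fromℕ< (ℕ.s≤s (position≤T x))))
            (trans (cong toℕ e) (Fin.toℕ-fromℕ< (ℕ.s≤s (position≤T y)))))

      σ : Permutation′ n
      σ = permutation (λ x → Fin.fromℕ< (position<n x)) (λ k → walk (toℕ k))
        (λ k → Fin.toℕ-injective
          (trans (Fin.toℕ-fromℕ< (position<n (walk (toℕ k)))) (position-walk (toℕ k) (k≤T k))))
        (λ x → trans (cong walk (Fin.toℕ-fromℕ< (position<n x))) (walk-position x))
        where k≤T : ∀ (k : Fin n) → toℕ k ℕ.≤ T
              k≤T k = ℕ.≤-pred (subst (toℕ k ℕ.<_) n≡1+T (Fin.toℕ<n k))

      label-σ : ∀ x → label σ x ≡ position x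
      label-σ x = Fin.toℕ-fromℕ< (position<n x)

      flow≡Δposition : ∀ a b → flow a b ≡ ℕtoℚ (position b) - ℕtoℚ (position a)
      flow≡Δposition a b = trans (cong₂ _-_ (u-at a) (u-at b))
        (solve 3 (λ U p q → (U :- p) :- (U :- q) := q :- p) refl (u i) (ℕtoℚ (position a)) (ℕtoℚ (position b)))
        where u-at : ∀ x → u x ≡ u i - ℕtoℚ (position x)
              u-at x = trans (cong u (sym (walk-position x))) (u-walk (position x) (missesJ-≤ (position≤T x) misses-T))

      Adjacent : ℕ → ℕ → Set
      Adjacent p q = p ≡ suc q ⊎ q ≡ suc p

      edge⇒adjacent : ∀ {a b} → A a b ≡ true → Adjacent (position a) (position b)
      edge⇒adjacent {a} {b} Aab with flow±1 Aab
      ... | inj₁ flow≡1 = inj₂ (ℕtoℚ-drop≡1 (trans (sym (flow≡Δposition a b)) flow≡1))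
      ... | inj₂ flow≡-1 = inj₁ (ℕtoℚ-drop≡1
        (trans (solve 2 (λ p q → p :- q := :- (q :- p)) refl (ℕtoℚ (position a)) (ℕtoℚ (position b)))
               (cong -_ (trans (sym (flow≡Δposition a b)) flow≡-1))))

      adjacent⇒edge : ∀ {a b} → Adjacent (position a) (position b) → A a b ≡ true
      adjacent⇒edge {a} {b} (inj₁ e) = trans (symA a b) (subst₂ (λ p q → A p q ≡ true)
        (walk-position b) (trans (cong walk (sym e)) (walk-position a))
        (walk-edge (position b) (subst (ℕ._≤ T) e (position≤T a))))
      adjacent⇒edge {a} {b} (inj₂ e) = subst₂ (λ p q → A p q ≡ true)
        (walk-position a) (trans (cong walk (sym e)) (walk-position b))
        (walk-edge (position a) (subst (ℕ._≤ T) e (position≤T b)))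

      unitFlow⇒path : IsPathWithEnds A i j
      unitFlow⇒path = σ , (λ a b → mk⇔ (λ Aab → relabel (sym (label-σ a)) (sym (label-σ b)) (edge⇒adjacent Aab))
                                        (λ adj → adjacent⇒edge (relabel (label-σ a) (label-σ b) adj)))
                        , inj₁ (i-bottom , j-top)
        where
          relabel : ∀ {p p′ q q′} → p ≡ p′ → q ≡ q′ → Adjacent p q → Adjacent p′ q′
          relabel refl refl adj = adj
          i-bottom : label σ i ≡ 0
          i-bottom = trans (label-σ i) (position-walk 0 ℕ.z≤n)
          j-top : label σ j ≡ n ∸ 1
          j-top = trans (label-σ j)
            (trans (cong position (sym walk-T)) (trans (position-walk T ℕ.≤-refl) (cong (_∸ 1) (sym n≡1+T))))

    Δcyc≡bound⇔path : (cyc A⁺ Ω⁺ - cyc A Ω ≡ ℕtoℚ (numEdges A ℕ.+ 1) * inv R) ⇔ IsPathWithEnds A i j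
    Δcyc≡bound⇔path = mk⇔ (λ tight → unitFlow⇒path (Equivalence.to Δcyc≡bound⇔unitFlow tight))
                          (λ path → Equivalence.from Δcyc≡bound⇔unitFlow (path⇒unitFlow path))

open EffectiveResistance using (module EdgeAddition; module EqualityCase)
open import Data.Bool using (false)
open import Data.Nat using (ℕ; _+_)
open import Data.Fin using (Fin)
open import Data.Rational using (ℚ; _<_; _≤_; _-_; _*_)
open import Data.Product using (_×_; _,_)
open import Relation.Binary.PropositionalEquality using (_≡_; _≢_)
open import Function.Bundles using (_⇔_)

mainTheorem3 : ∀ (n : ℕ) (A : Adj n) → IsSimple A → Connected A →
    ∀ (i j : Fin n) → i ≢ j → A i j ≡ false →
    ∀ (Ω Ω⁺ : Fin n → Fin n → ℚ) → IsResistance A Ω → IsResistance (addEdge A i j) Ω⁺ →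
    (inv (Ω i j) < cyc (addEdge A i j) Ω⁺ - cyc A Ω)
    × (cyc (addEdge A i j) Ω⁺ - cyc A Ω ≤ ℕtoℚ (numEdges A + 1) * inv (Ω i j))
    × ((cyc (addEdge A i j) Ω⁺ - cyc A Ω ≡ ℕtoℚ (numEdges A + 1) * inv (Ω i j))
    ⇔ IsPathWithEnds A i j)
mainTheorem3 n A (symA , loopless) conn i j i≢j Aij≡false Ω Ω⁺ res res⁺ =
  Δcyc-lower , Δcyc-upper , Δcyc≡bound⇔path
  where open EdgeAddition symA loopless conn i≢j Aij≡false res res⁺
        open EqualityCase symA loopless conn i≢j Aij≡false res res⁺
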